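{- As $n\to\infty$, \[ f_3(n,t)=\begin{cases} t & \text{for } t=1,2,\\ \Theta(\log\log n) & \text{for } t=3,4,\\ \Theta(\log n) & \text{for } t=5,6.\end{cases} \] (For $t=1,2$ the equality $f_3(n,t)=t$ holds for all sufficiently large $n$.)
   Context: For a positive integer $n$, $S_n$ denotes the set of permutations of $[n]=\{1,\dots,n\}$, each viewed as a linear ordering $P=(p_1,\dots,p_n)$ of $[n]$. For $P\in S_n$ and a $k$-element subset $X\subseteq[n]$, let $P_X\in S_k$ be the pattern of $X$ in $P$: writing $X=\{a_1<\dots<a_k\}$, $P_X$ is the ordering of $[k]$ in which $i$ precedes $j$ iff $a_i$ precedes $a_j$ in $P$. A family $\mathcal S\subseteq S_n$ partially shatters $X$ with $t$ orders if $|\{P_X:P\in\mathcal S\}|\ge t$. For $n\ge k$ and $1\le t\le k!$, $f_k(n,t)$ is the smallest size of a family $\mathcal S\subseteq S_n$ that partially shatters every $k$-element subset of $[n]$ with $t$ orders. Logarithms are base 2. -}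

module Defs where

open import Data.Nat using (ℕ; suc; _<_; _≤_; _*_; _<ᵇ_)
open import Data.Nat.Logarithm using (⌊log₂_⌋)
open import Data.Bool using (Bool)
open import Data.Fin using (Fin; toℕ; zero; suc)
open import Data.Fin.Permutation using (Permutation′; _⟨$⟩ʳ_; _⟨$⟩ˡ_)
open import Data.Product using (Σ; ∃; _×_)
open import Relation.Binary.PropositionalEquality using (_≡_; _≢_)

-- A permutation P ∈ S_n, viewed as the linear ordering (p_1,…,p_n) of [n]
-- (elements of [n] are represented by Fin n). Position i ↦ element P ⟨$⟩ʳ i.
Perm : ℕ → Set
Perm n = Permutation′ n

pos : ∀ {n} → Perm n → Fin n → ℕ
pos P x = toℕ (P ⟨$⟩ˡ x)

precedes : ∀ {n} → Perm n → Fin n → Fin n → Bool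
precedes P x y = pos P x <ᵇ pos P y

-- A k-element subset X = {a_1 < … < a_k} of [n], given by its increasing enumeration.
StrictlyIncreasing : ∀ {k n} → (Fin k → Fin n) → Set
StrictlyIncreasing {k} a = (i j : Fin k) → toℕ i < toℕ j → toℕ (a i) < toℕ (a j)

-- The pattern P_X ∈ S_k, represented by its precedence relation on [k]:
-- i precedes j in P_X iff a_i precedes a_j in P.
pattern-of : ∀ {k n} → Perm n → (Fin k → Fin n) → Fin k → Fin k → Bool
pattern-of P a i j = precedes P (a i) (a j)

DifferentPatterns : ∀ {k n} → Perm n → Perm n → (Fin k → Fin n) → Set
DifferentPatterns P Q a = ∃ λ i → ∃ λ j → pattern-of P a i j ≢ pattern-of Q a i j

-- A family S ⊆ S_n of size m, given as an injective enumeration Fin m → Perm n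
-- (two permutations are equal iff they are the same ordering).
Family : ℕ → ℕ → Set
Family n m = Fin m → Perm n

DistinctMembers : ∀ {n m} → Family n m → Set
DistinctMembers {n} {m} S = (i j : Fin m) → ((x : Fin n) → S i ⟨$⟩ʳ x ≡ S j ⟨$⟩ʳ x) → i ≡ j

-- S partially shatters X (enumerated by a) with t orders:
-- |{P_X : P ∈ S}| ≥ t, i.e. there are t members of S with pairwise different patterns on X.
PartiallyShatters : ∀ {k n m} → Family n m → (Fin k → Fin n) → ℕ → Set
PartiallyShatters {m = m} S a t =
  Σ (Fin t → Fin m) λ g → (i j : Fin t) → i ≢ j → DifferentPatterns (S (g i)) (S (g j)) a

ShattersAll : ∀ {n m} → (k : ℕ) → Family n m → ℕ → Set
ShattersAll {n} k S t = (a : Fin k → Fin n) → StrictlyIncreasing a → PartiallyShatters S a t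

Good : ℕ → ℕ → ℕ → ℕ → Set
Good k n t m = Σ (Family n m) λ S → DistinctMembers S × ShattersAll k S t

IsF : ℕ → ℕ → ℕ → ℕ → Set
IsF k n t m = Good k n t m × ((m′ : ℕ) → Good k n t m′ → m ≤ m′)

loglog : ℕ → ℕ
loglog n = ⌊log₂ ⌊log₂ n ⌋ ⌋

-- f_k(·,t) = Θ(h) as n → ∞ (constants: lower constant 1/c with c ≥ 1, upper constant C)
IsΘ : ℕ → ℕ → (ℕ → ℕ) → Set
IsΘ k t h = ∃ λ c → ∃ λ C → ∃ λ N → 1 ≤ c ×
  ((n : ℕ) → N ≤ n → ∃ λ m → IsF k n t m × h n ≤ c * m × m ≤ C * h n)

{-# OPTIONS --safe #-}
-- The pattern of a 3-set {a₀ < a₁ < a₂} in an ordering is fixed by the three comparisons between its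
-- elements, and f₃(n, t) exists as a number because goodness of a family is decidable by exhaustive
-- search; so it suffices to bound the size of good families from both sides.
--
-- Different patterns need different members, so t orders need t members. A triple that
-- every member orders monotonically has at most two patterns; iterating Erdős–Szekeres over the m
-- members finds one once n ≥ 3^(2^m), so three orders need log log n members. Two elements x, y on the
-- same side of the first element in every member, which pigeonhole provides once n > 2^m + 1, leave
-- at most four patterns on {0, x, y}, so five orders need ⌊log₂ n⌋ members.
--
-- The identity and its reversal give two orders. For six orders, take for each binary
-- digit the four orderings by that digit and then by position, each ascending or descending: in any
-- triple two digits isolate two different elements, every ordering of the triple puts one of these at
-- an end, and the four members of its digit realise exactly those orderings. For four orders, split
-- [s²] into s blocks of size s and build members on [s²] from members on [s], applying one of them to
-- blocks and to offsets alike, plus the two members ordering by block and then by ascending or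
-- descending offset. Every triple then gets two members placing different elements in the middle, and
-- together with their reversals these show four patterns; this uses 4r members on [2^(2^r)].
module Submission where

open import Defs
open import Data.Bool using (Bool; true; false; not; T; _xor_; if_then_else_)
open import Data.Bool.Properties using (not-¬; ¬-not; not-distribˡ-xor) renaming (_≟_ to _≟ᵇ_)
open import Data.Empty using (⊥; ⊥-elim)
open import Data.Fin using (Fin; zero; suc; toℕ; fromℕ<; punchOut; opposite; inject≤; combine; remQuot)
open import Data.Fin.Patterns using (0F; 1F; 2F; 3F; 4F; 5F)
open import Data.Fin.Permutation
  using (_⟨$⟩ʳ_; _⟨$⟩ˡ_; permutation; inverseˡ; inverseʳ; reverse) renaming (id to identity)
open import Data.Fin.Properties
  using (any?; all?; ¬∀⟶∃¬; pigeonhole; injective⇒≤; toℕ<n; toℕ-injective; toℕ-fromℕ<; toℕ-inject≤;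
         inject≤-injective; punchOut-injective; opposite-prop; opposite-involutive;
         combine-injectiveˡ; combine-injectiveʳ; combine-monoˡ-<; toℕ-combine; combine-remQuot; remQuot-combine)
  renaming (_≟_ to _≟ᶠ_)
open import Data.Fin.Subset using (Subset; ∣_∣; _∈_; _⊂_)
open import Data.Fin.Subset.Properties using (p⊂q⇒∣p∣<∣q∣; ∣⊤∣≡n; ∈⊤)
open import Data.List using (List; []; _∷_; length; map; filter; allFin)
open import Data.List.Properties using (length-map; length-tabulate)
open import Data.List.Relation.Binary.Sublist.Heterogeneous using (minimum)
open import Data.List.Relation.Binary.Sublist.Propositional using (_⊆_; []; _∷_; _∷ʳ_; ⊆-refl; ⊆-trans)
open import Data.List.Relation.Binary.Sublist.Propositional.Properties using (All-resp-⊆; filter-⊆; map⁺)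
open import Data.List.Relation.Unary.All using (All; []; _∷_)
import Data.List.Relation.Unary.All as All
import Data.List.Relation.Unary.All.Properties as All
open import Data.List.Relation.Unary.All.Properties using (all-filter)
open import Data.List.Relation.Unary.AllPairs using (AllPairs; []; _∷_)
import Data.List.Relation.Unary.AllPairs as AllPairs
import Data.List.Relation.Unary.AllPairs.Properties as AllPairs
open import Data.Nat using (ℕ; zero; suc; _≤_; _<_; _≮_; z≤n; s≤s; _<ᵇ_; _+_; _*_; _^_; _∸_; ⌊_/2⌋)
open import Data.Nat.Induction using (<-rec)
open import Data.Nat.Logarithm using (⌊log₂_⌋; ⌊log₂⌋-mono-≤; ⌊log₂⌊n/2⌋⌋≡⌊log₂n⌋∸1; ⌊log₂[2^n]⌋≡n)
open import Data.Nat.Properties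
  using (_≟_; _<?_; _≤?_; <ᵇ⇒<; <⇒<ᵇ; <-cmp; <-irrefl; <-asym; <-trans; <⇒≢; <⇒≤; ≰⇒>; ≮⇒≥; ≤∧≢⇒<;
         ≤-refl; ≤-reflexive; ≤-trans; ≤-pred; <-≤-trans; ≤-<-trans; m≤n⇒m≤1+n; module ≤-Reasoning;
         +-identityʳ; +-suc; +-mono-≤; +-monoˡ-≤; +-monoʳ-<; +-cancelˡ-<; ∸-monoʳ-<;
         *-identityˡ; *-suc; *-mono-≤; *-monoʳ-≤; *-monoʳ-<; *-cancelˡ-<; ^-monoʳ-≤; ^-distribˡ-+-*; m^n>0; ⌊n/2⌋<n)
open import Data.Product using (Σ; ∃; ∃₂; _×_; _,_; proj₁; proj₂)
open import Data.Sum using (_⊎_; inj₁; inj₂)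
import Data.Sum as Sum
open import Data.Unit using (tt)
open import Data.Vec using (tabulate)
open import Data.Vec.Functional using (Vector; head; tail) renaming (_∷_ to _∷ᶠ_)
open import Data.Vec.Functional.Relation.Binary.Pointwise using (Pointwise)
open import Data.Vec.Properties using (lookup∘tabulate; []=⇒lookup; lookup⇒[]=)
open import Function using (_∘_; id)
open import Relation.Binary.Definitions using (tri<; tri≈; tri>)
open import Relation.Binary.PropositionalEquality
  using (_≡_; _≢_; refl; sym; trans; cong; cong₂; subst; subst₂; module ≡-Reasoning)
open import Relation.Nullary using (Dec; yes; no; ¬_)
open import Relation.Nullary.Decidable using (map′; _×-dec_; _→-dec_; ¬?; decidable-stable)

<ᵇ≡true : ∀ {m n} → m < n → (m <ᵇ n) ≡ true
<ᵇ≡true {m} {n} m<n with m <ᵇ n in eq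
... | true  = refl
... | false = ⊥-elim (subst T eq (<⇒<ᵇ m<n))

<ᵇ≡false : ∀ {m n} → m ≮ n → (m <ᵇ n) ≡ false
<ᵇ≡false {m} {n} m≮n with m <ᵇ n in eq
... | false = refl
... | true  = ⊥-elim (m≮n (<ᵇ⇒< m n (subst T (sym eq) tt)))

<ᵇ-irrefl : ∀ n → (n <ᵇ n) ≡ false
<ᵇ-irrefl n = <ᵇ≡false {n} {n} (<-irrefl refl)

<ᵇ-cong-⇔ : ∀ {m n k l} → (m < n → k < l) → (k < l → m < n) → (m <ᵇ n) ≡ (k <ᵇ l)
<ᵇ-cong-⇔ {m} {n} to from with m <ᵇ n in eq
... | true  = sym (<ᵇ≡true (to (<ᵇ⇒< m n (subst T (sym eq) tt))))
... | false = sym (<ᵇ≡false (λ k<l → subst T eq (<⇒<ᵇ (from k<l))))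

<ᵇ-flip : ∀ {m n} → m ≢ n → (n <ᵇ m) ≡ not (m <ᵇ n)
<ᵇ-flip {m} {n} m≢n with <-cmp m n
... | tri< m<n _ _ rewrite <ᵇ≡true m<n | <ᵇ≡false (<-asym m<n) = refl
... | tri≈ _ m≡n _ = ⊥-elim (m≢n m≡n)
... | tri> _ _ n<m rewrite <ᵇ≡true n<m | <ᵇ≡false (<-asym n<m) = refl

opposite-< : ∀ {n} {i j : Fin n} → toℕ i < toℕ j → toℕ (opposite j) < toℕ (opposite i)
opposite-< {i = i} {j} i<j rewrite opposite-prop i | opposite-prop j = ∸-monoʳ-< (s≤s i<j) (toℕ<n j)

opposite-injective : ∀ {n} {i j : Fin n} → opposite i ≡ opposite j → i ≡ j
opposite-injective {i = i} {j} eq = trans (sym (opposite-involutive i)) (trans (cong opposite eq) (opposite-involutive j))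

opposite-<ᵇ : ∀ {n} (i j : Fin n) → (toℕ (opposite i) <ᵇ toℕ (opposite j)) ≡ (toℕ j <ᵇ toℕ i)
opposite-<ᵇ i j = <ᵇ-cong-⇔ undo opposite-<
  where
  undo : toℕ (opposite i) < toℕ (opposite j) → toℕ j < toℕ i
  undo lt = subst₂ (λ u v → toℕ u < toℕ v) (opposite-involutive j) (opposite-involutive i) (opposite-< lt)

-- Deciding goodness by exhaustive search

Searchable : (A : Set) → (A → A → Set) → Set₁
Searchable A _≈_ =
  (Q : A → Set) → (∀ {x y} → x ≈ y → Q x → Q y) → (∀ x → Dec (Q x)) → Dec (∃ Q)

search-Fin : ∀ n → Searchable (Fin n) _≡_
search-Fin n Q _ Q? = any? Q?

search-Vector : ∀ {A : Set} {_≈_ : A → A → Set} → (∀ {x} → x ≈ x) →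
                Searchable A _≈_ → ∀ m → Searchable (Vector A m) (Pointwise _≈_)
search-Vector rfl sA zero Q resp Q? with Q? (λ ())
... | yes q = yes (_ , q)
... | no ¬q = no λ (f , qf) → ¬q (resp (λ ()) qf)
search-Vector {A} {_≈_} rfl sA (suc m) Q resp Q? =
  map′ (λ (x , xs , q) → x ∷ᶠ xs , q)
       (λ (f , q) → head f , tail f , resp head∷tail q)
       (sA (λ x → ∃ λ xs → Q (x ∷ᶠ xs)) resp-head search-tail)
  where
  head∷tail : ∀ {f} → Pointwise _≈_ f (head f ∷ᶠ tail f)
  head∷tail zero    = rfl
  head∷tail (suc i) = rfl
  resp-head : ∀ {x y} → x ≈ y → (∃ λ xs → Q (x ∷ᶠ xs)) → ∃ λ xs → Q (y ∷ᶠ xs)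
  resp-head x≈y (xs , q) = xs , resp (λ { zero → x≈y ; (suc i) → rfl }) q
  search-tail : ∀ x → Dec (∃ λ xs → Q (x ∷ᶠ xs))
  search-tail x = search-Vector rfl sA m (λ xs → Q (x ∷ᶠ xs))
    (λ xs≈ys → resp (λ { zero → rfl ; (suc i) → xs≈ys i })) (λ xs → Q? (x ∷ᶠ xs))

search⇒∀? : ∀ {A : Set} {_≈_ : A → A → Set} → Searchable A _≈_ → (∀ {x y} → x ≈ y → y ≈ x) →
            (Q : A → Set) → (∀ {x y} → x ≈ y → Q x → Q y) → (∀ x → Dec (Q x)) → Dec (∀ x → Q x)
search⇒∀? search ≈-sym Q resp Q? with search (λ x → ¬ Q x) (λ x≈y ¬qx qy → ¬qx (resp (≈-sym x≈y) qy)) (λ x → ¬? (Q? x))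
... | yes (x , ¬qx) = no λ ∀q → ¬qx (∀q x)
... | no ∄¬q        = yes λ x → decidable-stable (Q? x) (λ ¬qx → ∄¬q (x , ¬qx))

record _≈ₚ_ {n} (P Q : Perm n) : Set where
  constructor mk≈ₚ
  field ⟨$⟩ʳ-≡ : ∀ x → P ⟨$⟩ʳ x ≡ Q ⟨$⟩ʳ x

≈ₚ-refl : ∀ {n} {P : Perm n} → P ≈ₚ P
≈ₚ-refl = mk≈ₚ λ _ → refl

≈ₚ⇒⟨$⟩ˡ-≡ : ∀ {n} {P Q : Perm n} → P ≈ₚ Q → ∀ y → P ⟨$⟩ˡ y ≡ Q ⟨$⟩ˡ y
≈ₚ⇒⟨$⟩ˡ-≡ {P = P} {Q} (mk≈ₚ P≈Q) y =
  trans (sym (inverseˡ Q)) (cong (Q ⟨$⟩ˡ_) (trans (sym (P≈Q (P ⟨$⟩ˡ y))) (inverseʳ P)))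

-- A permutation is searched for as a pair of mutually inverse functions.
search-Perm : ∀ n → Searchable (Perm n) _≈ₚ_
search-Perm n Q resp Q? =
  map′ (λ (f , g , inv , q) → permutation f g (proj₁ inv) (proj₂ inv) , q)
       (λ (P , q) → (P ⟨$⟩ʳ_) , (P ⟨$⟩ˡ_) , ((λ _ → inverseʳ P) , (λ _ → inverseˡ P)) , resp (mk≈ₚ λ _ → refl) q)
       (search-Fun (λ f → ∃ λ g → Σ (Inverses f g) λ inv → Q (toPerm f g inv)) resp-f search-g)
  where
  Inverses : (Fin n → Fin n) → (Fin n → Fin n) → Set
  Inverses f g = (∀ y → f (g y) ≡ y) × (∀ x → g (f x) ≡ x)
  toPerm : ∀ f g → Inverses f g → Perm n
  toPerm f g inv = permutation f g (proj₁ inv) (proj₂ inv)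
  search-Fun = search-Vector refl (search-Fin n) n
  resp-f : ∀ {f f′} → Pointwise _≡_ f f′ → (∃ λ g → Σ (Inverses f g) λ inv → Q (toPerm f g inv)) →
           ∃ λ g → Σ (Inverses f′ g) λ inv → Q (toPerm f′ g inv)
  resp-f f≗f′ (g , (fg , gf) , q) =
    g , ((λ y → trans (sym (f≗f′ (g y))) (fg y)) , (λ x → trans (cong g (sym (f≗f′ x))) (gf x))) , resp (mk≈ₚ f≗f′) q
  search-g : ∀ f → Dec (∃ λ g → Σ (Inverses f g) λ inv → Q (toPerm f g inv))
  search-g f = search-Fun _
    (λ g≗g′ ((fg , gf) , q) →
      ((λ y → trans (cong f (sym (g≗g′ y))) (fg y)) , (λ x → trans (sym (g≗g′ (f x))) (gf x))) ,
      resp (mk≈ₚ λ _ → refl) q)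
    dec
    where
    dec : ∀ g → Dec (Σ (Inverses f g) λ inv → Q (toPerm f g inv))
    dec g with all? (λ y → f (g y) ≟ᶠ y) ×-dec all? (λ x → g (f x) ≟ᶠ x)
    ... | no ¬inv = no λ (inv , _) → ¬inv inv
    ... | yes inv with Q? (toPerm f g inv)
    ...   | yes q = yes (inv , q)
    ...   | no ¬q = no λ (inv′ , q) → ¬q (resp (mk≈ₚ λ _ → refl) q)

pattern-of-resp : ∀ {k n} {P P′ : Perm n} {a a′ : Fin k → Fin n} → P ≈ₚ P′ → Pointwise _≡_ a a′ →
                  ∀ i j → pattern-of P a i j ≡ pattern-of P′ a′ i j
pattern-of-resp {P = P} {P′} P≈P′ a≗a′ i j = cong₂ (λ u v → toℕ u <ᵇ toℕ v) (pos≡ i) (pos≡ j)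
  where pos≡ = λ i → trans (cong (P ⟨$⟩ˡ_) (a≗a′ i)) (≈ₚ⇒⟨$⟩ˡ-≡ P≈P′ _)

differentPatterns? : ∀ {k n} (P Q : Perm n) (a : Fin k → Fin n) → Dec (DifferentPatterns P Q a)
differentPatterns? P Q a = any? λ i → any? λ j → ¬? (pattern-of P a i j ≟ᵇ pattern-of Q a i j)

differentPatterns-resp : ∀ {k n} {P P′ Q Q′ : Perm n} (a a′ : Fin k → Fin n) →
                         P ≈ₚ P′ → Q ≈ₚ Q′ → Pointwise _≡_ a a′ →
                         DifferentPatterns P Q a → DifferentPatterns P′ Q′ a′
differentPatterns-resp a a′ P≈P′ Q≈Q′ a≗a′ (i , j , differ) =
  i , j , λ eq → differ (trans (pattern-of-resp {a = a} P≈P′ a≗a′ i j)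
                     (trans eq (sym (pattern-of-resp {a = a} Q≈Q′ a≗a′ i j))))

partiallyShatters? : ∀ {k n m} (S : Family n m) (a : Fin k → Fin n) t → Dec (PartiallyShatters S a t)
partiallyShatters? {m = m} S a t = search-Vector refl (search-Fin m) t _
  (λ g≗g′ h i j i≢j → subst₂ (λ x y → DifferentPatterns (S x) (S y) a) (g≗g′ i) (g≗g′ j) (h i j i≢j))
  (λ g → all? λ i → all? λ j → ¬? (i ≟ᶠ j) →-dec differentPatterns? (S (g i)) (S (g j)) a)

partiallyShatters-resp : ∀ {k n m t} {S S′ : Family n m} (a a′ : Fin k → Fin n) →
                         Pointwise _≈ₚ_ S S′ → Pointwise _≡_ a a′ →
                         PartiallyShatters S a t → PartiallyShatters S′ a′ t
partiallyShatters-resp a a′ S≈S′ a≗a′ (g , h) =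
  g , λ i j i≢j → differentPatterns-resp a a′ (S≈S′ (g i)) (S≈S′ (g j)) a≗a′ (h i j i≢j)

strictlyIncreasing? : ∀ {k n} (a : Fin k → Fin n) → Dec (StrictlyIncreasing a)
strictlyIncreasing? a = all? λ i → all? λ j → (toℕ i <? toℕ j) →-dec (toℕ (a i) <? toℕ (a j))

shattersAll? : ∀ {n m} k (S : Family n m) t → Dec (ShattersAll k S t)
shattersAll? {n} k S t = search⇒∀? (search-Vector refl (search-Fin n) k) (λ a≗a′ i → sym (a≗a′ i)) _
  (λ {a} {a′} a≗a′ sh a′↑ → partiallyShatters-resp {S = S} a a′ (λ _ → ≈ₚ-refl) a≗a′
    (sh (λ i j i<j → subst₂ (λ u v → toℕ u < toℕ v) (sym (a≗a′ i)) (sym (a≗a′ j)) (a′↑ i j i<j))))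
  (λ a → strictlyIncreasing? a →-dec partiallyShatters? S a t)

distinctMembers? : ∀ {n m} (S : Family n m) → Dec (DistinctMembers S)
distinctMembers? S = all? λ i → all? λ j → all? (λ x → S i ⟨$⟩ʳ x ≟ᶠ S j ⟨$⟩ʳ x) →-dec (i ≟ᶠ j)

good? : ∀ k n t m → Dec (Good k n t m)
good? k n t m = search-Vector ≈ₚ-refl (search-Perm n) m _
  (λ S≈S′ (distinct , sh) →
    (λ i j Si≈Sj → distinct i j (λ x → trans (_≈ₚ_.⟨$⟩ʳ-≡ (S≈S′ i) x)
                                          (trans (Si≈Sj x) (sym (_≈ₚ_.⟨$⟩ʳ-≡ (S≈S′ j) x))))) ,
    (λ a a↑ → partiallyShatters-resp a a S≈S′ (λ _ → refl) (sh a a↑)))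
  (λ S → distinctMembers? S ×-dec shattersAll? k S t)

least : ∀ {P : ℕ → Set} → (∀ n → Dec (P n)) → ∀ m → P m → ∃ λ k → P k × (∀ j → P j → k ≤ j)
least {P} P? = <-rec (λ m → P m → ∃ λ k → P k × (∀ j → P j → k ≤ j)) step
  where
  step : ∀ m → (∀ {j} → j < m → P j → ∃ λ k → P k × (∀ j → P j → k ≤ j)) →
         P m → ∃ λ k → P k × (∀ j → P j → k ≤ j)
  step m rec pm with any? (λ (j : Fin m) → P? (toℕ j))
  ... | yes (j , pj) = rec (toℕ<n j) pj
  ... | no ∄j        = m , pm , λ j pj → ≮⇒≥ λ j<m →
                         ∄j (fromℕ< j<m , subst P (sym (toℕ-fromℕ< j<m)) pj)

record DistinctCover {n m} (S : Family n m) : Set where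
  field
    size     : ℕ
    members  : Family n size
    size≤m   : size ≤ m
    distinct : DistinctMembers members
    covers   : ∀ i → ∃ λ j → S i ≈ₚ members j

distinctCover : ∀ {n m} (S : Family n m) → DistinctCover S
distinctCover {m = zero} S = record { size = 0 ; members = λ () ; size≤m = z≤n ; distinct = λ () ; covers = λ () }
distinctCover {m = suc m} S with distinctCover (tail S)
... | record { size = size ; members = T ; size≤m = size≤m ; distinct = distinct ; covers = covers }
  with any? (λ j → all? (λ x → head S ⟨$⟩ʳ x ≟ᶠ T j ⟨$⟩ʳ x))
... | yes (j , S₀≈Tj) = record
  { size = size ; members = T ; size≤m = m≤n⇒m≤1+n size≤m ; distinct = distinct
  ; covers = λ { zero → j , mk≈ₚ S₀≈Tj ; (suc i) → covers i } }
... | no S₀∉T = record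
  { size = suc size ; members = head S ∷ᶠ T ; size≤m = s≤s size≤m ; distinct = distinct′
  ; covers = λ { zero → zero , ≈ₚ-refl ; (suc i) → suc (proj₁ (covers i)) , proj₂ (covers i) } }
  where
  distinct′ : DistinctMembers (head S ∷ᶠ T)
  distinct′ zero    zero    _ = refl
  distinct′ zero    (suc j) h = ⊥-elim (S₀∉T (j , h))
  distinct′ (suc i) zero    h = ⊥-elim (S₀∉T (i , λ x → sym (h x)))
  distinct′ (suc i) (suc j) h = cong suc (distinct i j h)

shattersAll-cover : ∀ {k n m t} {S : Family n m} (C : DistinctCover S) →
                    ShattersAll k S t → ShattersAll k (DistinctCover.members C) t
shattersAll-cover C sh a a↑ with sh a a↑
... | g , h = (λ i → proj₁ (covers (g i))) , λ i j i≢j →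
  differentPatterns-resp a a (proj₂ (covers (g i))) (proj₂ (covers (g j))) (λ _ → refl) (h i j i≢j)
  where open DistinctCover C

shattersAll⇒f≤m : ∀ {k n t m} (S : Family n m) → ShattersAll k S t → ∃ λ f → IsF k n t f × f ≤ m
shattersAll⇒f≤m {k} {n} {t} S sh = proj₁ smallest , proj₂ smallest , ≤-trans (proj₂ (proj₂ smallest) size good) size≤m
  where
  C : DistinctCover S
  C = distinctCover S
  open DistinctCover C
  good : Good k n t size
  good = members , distinct , shattersAll-cover C sh
  smallest = least (good? k n t) size good

injective⇒surjective : ∀ {n} (f : Fin n → Fin n) → (∀ {x y} → f x ≡ f y → x ≡ y) → ∀ y → ∃ λ x → f x ≡ y
injective⇒surjective {suc n} f f-inj y with any? (λ x → f x ≟ᶠ y)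
... | yes found = found
... | no  ∄x    = ⊥-elim (<-irrefl refl (injective⇒≤ punchOut∘f-injective))
  where
  y≢f : ∀ x → y ≢ f x
  y≢f x y≡fx = ∄x (x , sym y≡fx)
  punchOut∘f : Fin (suc n) → Fin n
  punchOut∘f x = punchOut (y≢f x)
  punchOut∘f-injective : ∀ {x x′} → punchOut∘f x ≡ punchOut∘f x′ → x ≡ x′
  punchOut∘f-injective {x} {x′} eq = f-inj (punchOut-injective (y≢f x) (y≢f x′) eq)

-- Each x is placed at position |{z : key z < key x}|.
module OrderedBy {n} (key : Fin n → ℕ) (key-injective : ∀ {x y} → key x ≡ key y → x ≡ y) where

  below : Fin n → Subset n
  below x = tabulate λ z → key z <ᵇ key x

  ∈-below : ∀ {x z} → key z < key x → z ∈ below x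
  ∈-below {x} {z} z<x = lookup⇒[]= z (below x) (trans (lookup∘tabulate _ z) (<ᵇ≡true z<x))

  below⇒< : ∀ {x z} → z ∈ below x → key z < key x
  below⇒< {x} {z} z∈ = <ᵇ⇒< (key z) (key x)
    (subst T (sym (trans (sym (lookup∘tabulate _ z)) ([]=⇒lookup z∈))) tt)

  below-⊂ : ∀ {x y} → key x < key y → below x ⊂ below y
  below-⊂ x<y = (λ z∈ → ∈-below (<-trans (below⇒< z∈) x<y)) , _ , ∈-below x<y , λ x∈ → <-irrefl refl (below⇒< x∈)

  rank : Fin n → ℕ
  rank x = ∣ below x ∣

  rank<n : ∀ x → rank x < n
  rank<n x = subst (rank x <_) (∣⊤∣≡n n) (p⊂q⇒∣p∣<∣q∣ ((λ _ → ∈⊤) , x , ∈⊤ , λ x∈ → <-irrefl refl (below⇒< x∈)))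

  rank-mono-< : ∀ {x y} → key x < key y → rank x < rank y
  rank-mono-< x<y = p⊂q⇒∣p∣<∣q∣ (below-⊂ x<y)

  rank-cancel-< : ∀ {x y} → rank x < rank y → key x < key y
  rank-cancel-< {x} {y} rx<ry with <-cmp (key x) (key y)
  ... | tri< x<y _ _ = x<y
  ... | tri≈ _ x≡y _ rewrite key-injective x≡y = ⊥-elim (<-irrefl refl rx<ry)
  ... | tri> _ _ y<x = ⊥-elim (<-asym rx<ry (rank-mono-< y<x))

  position : Fin n → Fin n
  position x = fromℕ< (rank<n x)

  position-injective : ∀ {x y} → position x ≡ position y → x ≡ y
  position-injective {x} {y} eq with <-cmp (key x) (key y)
  ... | tri< x<y _ _ = ⊥-elim (<⇒≢ (rank-mono-< x<y) rx≡ry)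
    where rx≡ry = trans (sym (toℕ-fromℕ< _)) (trans (cong toℕ eq) (toℕ-fromℕ< _))
  ... | tri≈ _ x≡y _ = key-injective x≡y
  ... | tri> _ _ y<x = ⊥-elim (<⇒≢ (rank-mono-< y<x) (sym rx≡ry))
    where rx≡ry = trans (sym (toℕ-fromℕ< _)) (trans (cong toℕ eq) (toℕ-fromℕ< _))

  ordering : Perm n
  ordering = permutation (λ i → proj₁ (onto i)) position
    (λ x → position-injective (proj₂ (onto (position x)))) (λ i → proj₂ (onto i))
    where onto = injective⇒surjective position position-injective

  precedes-ordering : ∀ x y → precedes ordering x y ≡ (key x <ᵇ key y)
  precedes-ordering x y rewrite toℕ-fromℕ< (rank<n x) | toℕ-fromℕ< (rank<n y) =
    <ᵇ-cong-⇔ rank-cancel-< rank-mono-<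

triple : ∀ {n} → Fin n → Fin n → Fin n → Fin 3 → Fin n
triple x y z 0F = x
triple x y z 1F = y
triple x y z 2F = z

triple-increasing : ∀ {n} {x y z : Fin n} → toℕ x < toℕ y → toℕ y < toℕ z → StrictlyIncreasing (triple x y z)
triple-increasing x<y y<z 0F 1F _ = x<y
triple-increasing x<y y<z 0F 2F _ = <-trans x<y y<z
triple-increasing x<y y<z 1F 2F _ = y<z
triple-increasing x<y y<z 0F 0F ()
triple-increasing x<y y<z 1F 0F ()
triple-increasing x<y y<z 1F 1F (s≤s ())
triple-increasing x<y y<z 2F 0F ()
triple-increasing x<y y<z 2F 1F (s≤s ())
triple-increasing x<y y<z 2F 2F (s≤s (s≤s ()))

increasing-injective : ∀ {k n} {a : Fin k → Fin n} → StrictlyIncreasing a → ∀ {i j} → a i ≡ a j → i ≡ j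
increasing-injective {a = a} a↑ {i} {j} ai≡aj with <-cmp (toℕ i) (toℕ j)
... | tri< i<j _ _ = ⊥-elim (<⇒≢ (a↑ i j i<j) (cong toℕ ai≡aj))
... | tri≈ _ i≡j _ = toℕ-injective i≡j
... | tri> _ _ j<i = ⊥-elim (<⇒≢ (a↑ j i j<i) (cong toℕ (sym ai≡aj)))

Distinct₃ : ∀ {n} → (Fin 3 → Fin n) → Set
Distinct₃ a = (a 0F ≢ a 1F) × (a 0F ≢ a 2F) × (a 1F ≢ a 2F)

distinct₃? : ∀ {n} (a : Fin 3 → Fin n) → Dec (Distinct₃ a)
distinct₃? a = ¬? (a 0F ≟ᶠ a 1F) ×-dec ¬? (a 0F ≟ᶠ a 2F) ×-dec ¬? (a 1F ≟ᶠ a 2F)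

distinct₃-map : ∀ {n p} {f : Fin n → Fin p} → (∀ {x y} → f x ≡ f y → x ≡ y) →
                ∀ {a} → Distinct₃ a → Distinct₃ (f ∘ a)
distinct₃-map f-injective (≢₀₁ , ≢₀₂ , ≢₁₂) = ≢₀₁ ∘ f-injective , ≢₀₂ ∘ f-injective , ≢₁₂ ∘ f-injective

increasing⇒distinct₃ : ∀ {n} {a : Fin 3 → Fin n} → StrictlyIncreasing a → Distinct₃ a
increasing⇒distinct₃ a↑ = (λ ()) ∘ increasing-injective a↑ , (λ ()) ∘ increasing-injective a↑ ,
                          (λ ()) ∘ increasing-injective a↑

-- The outcomes of the comparisons of a₀ with a₁, a₀ with a₂ and a₁ with a₂, which determine the pattern.
Sig : Set
Sig = Bool × Bool × Bool

sig : ∀ {n} → Perm n → (Fin 3 → Fin n) → Sig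
sig P a = pattern-of P a 0F 1F , pattern-of P a 0F 2F , pattern-of P a 1F 2F

pos-injective : ∀ {n} (P : Perm n) {x y} → pos P x ≡ pos P y → x ≡ y
pos-injective P {x} {y} eq = trans (sym (inverseʳ P)) (trans (cong (P ⟨$⟩ʳ_) (toℕ-injective eq)) (inverseʳ P))

pattern-of-flip : ∀ {n} (P : Perm n) (a : Fin 3 → Fin n) i j → a i ≢ a j →
                  pattern-of P a j i ≡ not (pattern-of P a i j)
pattern-of-flip P a i j ai≢aj = <ᵇ-flip (λ eq → ai≢aj (pos-injective P eq))

pattern-of-diag : ∀ {n} (P : Perm n) (a : Fin 3 → Fin n) i → pattern-of P a i i ≡ false
pattern-of-diag P a i = <ᵇ-irrefl (pos P (a i))

sig≡⇒¬differentPatterns : ∀ {n} (P Q : Perm n) {a : Fin 3 → Fin n} → Distinct₃ a → sig P a ≡ sig Q a →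
                    ¬ DifferentPatterns P Q a
sig≡⇒¬differentPatterns P Q {a} (a₀≢a₁ , a₀≢a₂ , a₁≢a₂) eq (i , j , differ) = differ (same i j)
  where
  flipped : ∀ i j → a i ≢ a j → pattern-of P a i j ≡ pattern-of Q a i j → pattern-of P a j i ≡ pattern-of Q a j i
  flipped i j ai≢aj e = trans (pattern-of-flip P a i j ai≢aj) (trans (cong not e) (sym (pattern-of-flip Q a i j ai≢aj)))
  same : ∀ i j → pattern-of P a i j ≡ pattern-of Q a i j
  same 0F 1F = cong proj₁ eq
  same 0F 2F = cong (proj₁ ∘ proj₂) eq
  same 1F 2F = cong (proj₂ ∘ proj₂) eq
  same 1F 0F = flipped 0F 1F a₀≢a₁ (same 0F 1F)
  same 2F 0F = flipped 0F 2F a₀≢a₂ (same 0F 2F)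
  same 2F 1F = flipped 1F 2F a₁≢a₂ (same 1F 2F)
  same 0F 0F = trans (pattern-of-diag P a 0F) (sym (pattern-of-diag Q a 0F))
  same 1F 1F = trans (pattern-of-diag P a 1F) (sym (pattern-of-diag Q a 1F))
  same 2F 2F = trans (pattern-of-diag P a 2F) (sym (pattern-of-diag Q a 2F))

sig≢⇒differentPatterns : ∀ {n} (P Q : Perm n) (a : Fin 3 → Fin n) → sig P a ≢ sig Q a → DifferentPatterns P Q a
sig≢⇒differentPatterns P Q a sig≢ with pattern-of P a 0F 1F ≟ᵇ pattern-of Q a 0F 1F
                                  | pattern-of P a 0F 2F ≟ᵇ pattern-of Q a 0F 2F
                                  | pattern-of P a 1F 2F ≟ᵇ pattern-of Q a 1F 2F
... | no  ≢₀₁ | _         | _     = 0F , 1F , ≢₀₁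
... | yes _   | no  ≢₀₂   | _     = 0F , 2F , ≢₀₂
... | yes _   | yes _     | no ≢₁₂ = 1F , 2F , ≢₁₂
... | yes ≡₀₁ | yes ≡₀₂   | yes ≡₁₂ = ⊥-elim (sig≢ (cong₂ _,_ ≡₀₁ (cong₂ _,_ ≡₀₂ ≡₁₂)))

shatters-by-realising : ∀ {n m t} (S : Family n m) (a : Fin 3 → Fin n) (σ : Fin t → Sig) →
                        (∀ {k l} → σ k ≡ σ l → k ≡ l) → (∀ k → ∃ λ i → sig (S i) a ≡ σ k) → PartiallyShatters S a t
shatters-by-realising S a σ σ-injective realise = g , λ k l k≢l →
  sig≢⇒differentPatterns (S (g k)) (S (g l)) a
    λ eq → k≢l (σ-injective (trans (sym (proj₂ (realise k))) (trans eq (proj₂ (realise l)))))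
  where
  g = proj₁ ∘ realise

shattering⇒sigs-differ : ∀ {n m t} (S : Family n m) {a : Fin 3 → Fin n} → Distinct₃ a →
                         ((g , _) : PartiallyShatters S a t) → ∀ {i j} → i ≢ j → sig (S (g i)) a ≢ sig (S (g j)) a
shattering⇒sigs-differ S distinct (g , h) i≢j eq = sig≡⇒¬differentPatterns (S (g _)) (S (g _)) distinct eq (h _ _ i≢j)

partiallyShatters-≤ : ∀ {k n m t t′} (S : Family n m) (a : Fin k → Fin n) → t′ ≤ t →
                      PartiallyShatters S a t → PartiallyShatters S a t′
partiallyShatters-≤ S a t′≤t (g , h) =
  (λ i → g (inject≤ i t′≤t)) , λ i j i≢j → h _ _ λ eq → i≢j (inject≤-injective t′≤t t′≤t i j eq)

shattersAll-≤ : ∀ {k n m t t′} (S : Family n m) → t′ ≤ t → ShattersAll k S t → ShattersAll k S t′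
shattersAll-≤ S t′≤t sh a a↑ = partiallyShatters-≤ S a t′≤t (sh a a↑)

keySig : ∀ {n} → (Fin n → ℕ) → (Fin 3 → Fin n) → Sig
keySig key a = (key (a 0F) <ᵇ key (a 1F)) , (key (a 0F) <ᵇ key (a 2F)) , (key (a 1F) <ᵇ key (a 2F))

sig-ordering : ∀ {n} (key : Fin n → ℕ) (key-injective : ∀ {x y} → key x ≡ key y → x ≡ y) (a : Fin 3 → Fin n) →
               sig (OrderedBy.ordering key key-injective) a ≡ keySig key a
sig-ordering key key-injective a = cong₂ _,_ (prec _ _) (cong₂ _,_ (prec _ _) (prec _ _))
  where prec = OrderedBy.precedes-ordering key key-injective

-- At most two orders

initial-triple : ∀ {n} → 3 ≤ n → Fin 3 → Fin n
initial-triple 3≤n i = inject≤ i 3≤n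

initial-triple-increasing : ∀ {n} (3≤n : 3 ≤ n) → StrictlyIncreasing (initial-triple 3≤n)
initial-triple-increasing 3≤n i j i<j rewrite toℕ-inject≤ i 3≤n | toℕ-inject≤ j 3≤n = i<j

shattersAll⇒t≤m : ∀ {n m t} → 3 ≤ n → (S : Family n m) → ShattersAll 3 S t → t ≤ m
shattersAll⇒t≤m 3≤n S sh with sh (initial-triple 3≤n) (initial-triple-increasing 3≤n)
... | g , h = injective⇒≤ g-injective
  where
  g-injective : ∀ {i j} → g i ≡ g j → i ≡ j
  g-injective {i} {j} gi≡gj with i ≟ᶠ j
  ... | yes i≡j = i≡j
  ... | no i≢j with h i j i≢j
  ...   | u , v , differ = ⊥-elim (differ (cong (λ k → pattern-of (S k) (initial-triple 3≤n) u v) gi≡gj))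

identity-reverse-differ : ∀ {n} {a : Fin 3 → Fin n} → StrictlyIncreasing a → DifferentPatterns identity reverse a
identity-reverse-differ {a = a} a↑ = 0F , 1F , λ eq → true≢false (begin
  true                                           ≡⟨ sym (<ᵇ≡true a₀<a₁) ⟩
  toℕ (a 0F) <ᵇ toℕ (a 1F)                       ≡⟨ eq ⟩
  toℕ (opposite (a 0F)) <ᵇ toℕ (opposite (a 1F)) ≡⟨ opposite-<ᵇ (a 0F) (a 1F) ⟩
  toℕ (a 1F) <ᵇ toℕ (a 0F)                       ≡⟨ <ᵇ≡false (<-asym a₀<a₁) ⟩
  false                                          ∎)
  where
  open ≡-Reasoning
  a₀<a₁ = a↑ 0F 1F (s≤s z≤n)
  true≢false : true ≢ false
  true≢false ()

f≡t-for-t≤2 : (t : ℕ) → 1 ≤ t → t ≤ 2 → ∃ λ N → (n : ℕ) → N ≤ n → IsF 3 n t t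
f≡t-for-t≤2 1 _ _ = 3 , λ n 3≤n → (good₁ , λ m (S , _ , sh) → shattersAll⇒t≤m 3≤n S sh)
  where
  good₁ : ∀ {n} → Good 3 n 1 1
  good₁ = (λ _ → identity) , (λ { 0F 0F _ → refl }) , λ a a↑ → (λ _ → 0F) , λ { 0F 0F 0≢0 → ⊥-elim (0≢0 refl) }
f≡t-for-t≤2 2 _ _ = 3 , λ n 3≤n → (good₂ 3≤n , λ m (S , _ , sh) → shattersAll⇒t≤m 3≤n S sh)
  where
  identity∷reverse : ∀ {n} → Family n 2
  identity∷reverse 0F = identity
  identity∷reverse 1F = reverse
  good₂ : ∀ {n} → 3 ≤ n → Good 3 n 2 2
  good₂ 3≤n = identity∷reverse , distinct , λ a a↑ → (λ i → i) , differ a↑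
    where
    identity≉reverse : ¬ (∀ x → identity ⟨$⟩ʳ x ≡ reverse ⟨$⟩ʳ x)
    identity≉reverse identity≈reverse with identity-reverse-differ (initial-triple-increasing 3≤n)
    ... | i , j , differ′ =
      differ′ (pattern-of-resp {P = identity} {reverse} {a = initial-triple 3≤n} (mk≈ₚ identity≈reverse) (λ _ → refl) i j)
    distinct : DistinctMembers identity∷reverse
    distinct 0F 0F _ = refl
    distinct 0F 1F h = ⊥-elim (identity≉reverse h)
    distinct 1F 0F h = ⊥-elim (identity≉reverse λ x → sym (h x))
    distinct 1F 1F _ = refl
    differ : ∀ {a} → StrictlyIncreasing a → ∀ i j → i ≢ j → DifferentPatterns (identity∷reverse i) (identity∷reverse j) a
    differ a↑ 0F 0F 0≢0 = ⊥-elim (0≢0 refl)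
    differ a↑ 0F 1F _   = identity-reverse-differ a↑
    differ a↑ 1F 0F _ with identity-reverse-differ a↑
    ... | u , v , differ′ = u , v , λ eq → differ′ (sym eq)
    differ a↑ 1F 1F 1≢1 = ⊥-elim (1≢1 refl)
f≡t-for-t≤2 (suc (suc (suc _))) _ (s≤s (s≤s ()))

2*⌊n/2⌋≤n : ∀ n → 2 * ⌊ n /2⌋ ≤ n
2*⌊n/2⌋≤n 0             = z≤n
2*⌊n/2⌋≤n 1             = z≤n
2*⌊n/2⌋≤n (suc (suc n)) = subst (_≤ suc (suc n)) (sym (*-suc 2 ⌊ n /2⌋)) (s≤s (s≤s (2*⌊n/2⌋≤n n)))

n<2*[1+⌊n/2⌋] : ∀ n → n < 2 * suc ⌊ n /2⌋
n<2*[1+⌊n/2⌋] 0             = s≤s z≤n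
n<2*[1+⌊n/2⌋] 1             = s≤s (s≤s z≤n)
n<2*[1+⌊n/2⌋] (suc (suc n)) =
  subst (suc (suc n) <_) (sym (*-suc 2 (suc ⌊ n /2⌋))) (s≤s (s≤s (n<2*[1+⌊n/2⌋] n)))

n<2^[1+k]⇒⌊log₂n⌋≤k : ∀ k n → n < 2 ^ suc k → ⌊log₂ n ⌋ ≤ k
n<2^[1+k]⇒⌊log₂n⌋≤k zero    n n<2 = subst (⌊log₂ n ⌋ ≤_) (⌊log₂[2^n]⌋≡n 0) (⌊log₂⌋-mono-≤ (≤-pred n<2))
n<2^[1+k]⇒⌊log₂n⌋≤k (suc k) n n<2^[2+k] = log∸1≤k⇒log≤1+k ⌊log₂ n ⌋
  (subst (_≤ k) (⌊log₂⌊n/2⌋⌋≡⌊log₂n⌋∸1 n) (n<2^[1+k]⇒⌊log₂n⌋≤k k ⌊ n /2⌋ half<))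
  where
  half< : ⌊ n /2⌋ < 2 ^ suc k
  half< = *-cancelˡ-< 2 ⌊ n /2⌋ (2 ^ suc k) (≤-<-trans (2*⌊n/2⌋≤n n) n<2^[2+k])
  log∸1≤k⇒log≤1+k : ∀ l → l ∸ 1 ≤ k → l ≤ suc k
  log∸1≤k⇒log≤1+k zero    _ = z≤n
  log∸1≤k⇒log≤1+k (suc l) l≤k = s≤s l≤k

n<2^k⇒⌊log₂n⌋<k : ∀ {k} n → 0 < k → n < 2 ^ k → ⌊log₂ n ⌋ < k
n<2^k⇒⌊log₂n⌋<k {suc k} n _ n<2^[1+k] = s≤s (n<2^[1+k]⇒⌊log₂n⌋≤k k n n<2^[1+k])

2^k≤n⇒k≤⌊log₂n⌋ : ∀ k {n} → 2 ^ k ≤ n → k ≤ ⌊log₂ n ⌋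
2^k≤n⇒k≤⌊log₂n⌋ k 2^k≤n = subst (_≤ _) (⌊log₂[2^n]⌋≡n k) (⌊log₂⌋-mono-≤ 2^k≤n)

n<2^[1+⌊log₂n⌋] : ∀ n → n < 2 ^ suc ⌊log₂ n ⌋
n<2^[1+⌊log₂n⌋] = <-rec (λ n → n < 2 ^ suc ⌊log₂ n ⌋) step
  where
  step : ∀ n → (∀ {h} → h < n → h < 2 ^ suc ⌊log₂ h ⌋) → n < 2 ^ suc ⌊log₂ n ⌋
  step 0 _ = s≤s z≤n
  step 1 _ = s≤s (s≤s z≤n)
  step n@(suc (suc n-2)) rec = <-≤-trans (n<2*[1+⌊n/2⌋] n) (*-monoʳ-≤ 2 half<)
    where
    1≤log : 1 ≤ ⌊log₂ n ⌋
    1≤log = 2^k≤n⇒k≤⌊log₂n⌋ 1 {n} (s≤s (s≤s z≤n))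
    1+[l∸1]≡l : ∀ {l} → 1 ≤ l → suc (l ∸ 1) ≡ l
    1+[l∸1]≡l (s≤s z≤n) = refl
    half< : ⌊ n /2⌋ < 2 ^ ⌊log₂ n ⌋
    half< = subst (λ e → ⌊ n /2⌋ < 2 ^ e)
      (trans (cong suc (⌊log₂⌊n/2⌋⌋≡⌊log₂n⌋∸1 n)) (1+[l∸1]≡l 1≤log)) (rec {⌊ n /2⌋} (⌊n/2⌋<n (suc n-2)))

fromBool : Bool → Fin 2
fromBool false = 0F
fromBool true  = 1F

fromBool-injective : ∀ {b c} → fromBool b ≡ fromBool c → b ≡ c
fromBool-injective {false} {false} _ = refl
fromBool-injective {true}  {true}  _ = refl

toBool : Fin 2 → Bool
toBool 0F = false
toBool 1F = true

fromBool-toBool : ∀ b → fromBool (toBool b) ≡ b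
fromBool-toBool 0F = refl
fromBool-toBool 1F = refl

toBool-fromBool : ∀ b → toBool (fromBool b) ≡ b
toBool-fromBool false = refl
toBool-fromBool true  = refl

fromBool-<ᵇ : ∀ {b c} → b ≢ c → (toℕ (fromBool b) <ᵇ toℕ (fromBool c)) ≡ not b
fromBool-<ᵇ {false} {false} b≢c = ⊥-elim (b≢c refl)
fromBool-<ᵇ {false} {true}  _   = refl
fromBool-<ᵇ {true}  {false} _   = refl
fromBool-<ᵇ {true}  {true}  b≢c = ⊥-elim (b≢c refl)

encode : ∀ {m} → (Fin m → Bool) → Fin (2 ^ m)
encode {zero}  f = 0F
encode {suc m} f = combine (fromBool (head f)) (encode (tail f))

encode-injective : ∀ {m} (f g : Fin m → Bool) → encode f ≡ encode g → ∀ i → f i ≡ g i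
encode-injective {suc m} f g eq zero =
  fromBool-injective (combine-injectiveˡ (fromBool (head f)) (encode (tail f)) (fromBool (head g)) (encode (tail g)) eq)
encode-injective {suc m} f g eq (suc i) =
  encode-injective (tail f) (tail g)
    (combine-injectiveʳ (fromBool (head f)) (encode (tail f)) (fromBool (head g)) (encode (tail g)) eq) i

encode-cong : ∀ {m} {f g : Fin m → Bool} → (∀ i → f i ≡ g i) → encode f ≡ encode g
encode-cong {zero}  _   = refl
encode-cong {suc m} f≗g = cong₂ combine (cong fromBool (f≗g 0F)) (encode-cong (f≗g ∘ suc))

decode : ∀ {m} → Fin (2 ^ m) → Fin m → Bool
decode {zero}  _ ()
decode {suc m} k = toBool (proj₁ (remQuot {2} (2 ^ m) k)) ∷ᶠ decode {m} (proj₂ (remQuot {2} (2 ^ m) k))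

encode-decode : ∀ {m} (k : Fin (2 ^ m)) → encode {m} (decode {m} k) ≡ k
encode-decode {zero}  0F = refl
encode-decode {suc m} k  =
  trans (cong₂ combine (fromBool-toBool (proj₁ (remQuot {2} (2 ^ m) k)))
                       (encode-decode {m} (proj₂ (remQuot {2} (2 ^ m) k))))
        (combine-remQuot {2} (2 ^ m) k)

decode-separates : ∀ {m} {k l : Fin (2 ^ m)} → k ≢ l → ∃ λ i → decode {m} k i ≢ decode {m} l i
decode-separates {m} {k} {l} k≢l = ¬∀⟶∃¬ m _ (λ i → decode {m} k i ≟ᵇ decode {m} l i) λ same →
  k≢l (trans (sym (encode-decode {m} k)) (trans (encode-cong {m} same) (encode-decode {m} l)))

lex : ∀ {n p q} → (Fin n → Fin p) → (Fin n → Fin q) → Fin n → Fin (p * q)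
lex hi lo x = combine (hi x) (lo x)

lex-injective : ∀ {n p q} (hi : Fin n → Fin p) (lo : Fin n → Fin q) →
                (∀ {x y} → hi x ≡ hi y → lo x ≡ lo y → x ≡ y) → ∀ {x y} → lex hi lo x ≡ lex hi lo y → x ≡ y
lex-injective hi lo separates {x} {y} eq =
  separates (combine-injectiveˡ (hi x) (lo x) (hi y) (lo y) eq) (combine-injectiveʳ (hi x) (lo x) (hi y) (lo y) eq)

lex-<ᵇ-high : ∀ {n p q} (hi : Fin n → Fin p) (lo : Fin n → Fin q) {x y} → hi x ≢ hi y →
              (toℕ (lex hi lo x) <ᵇ toℕ (lex hi lo y)) ≡ (toℕ (hi x) <ᵇ toℕ (hi y))
lex-<ᵇ-high hi lo {x} {y} hx≢hy with <-cmp (toℕ (hi x)) (toℕ (hi y))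
... | tri< hx<hy _ _ = trans (<ᵇ≡true (combine-monoˡ-< (lo x) (lo y) hx<hy)) (sym (<ᵇ≡true hx<hy))
... | tri≈ _ hx≡hy _ = ⊥-elim (hx≢hy (toℕ-injective hx≡hy))
... | tri> _ _ hy<hx = trans (<ᵇ≡false (<-asym (combine-monoˡ-< (lo y) (lo x) hy<hx))) (sym (<ᵇ≡false (<-asym hy<hx)))

lex-<ᵇ-low : ∀ {n p q} (hi : Fin n → Fin p) (lo : Fin n → Fin q) {x y} → hi x ≡ hi y →
             (toℕ (lex hi lo x) <ᵇ toℕ (lex hi lo y)) ≡ (toℕ (lo x) <ᵇ toℕ (lo y))
lex-<ᵇ-low {q = q} hi lo {x} {y} hx≡hy rewrite toℕ-combine (hi x) (lo x) | toℕ-combine (hi y) (lo y) | hx≡hy =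
  <ᵇ-cong-⇔ (+-cancelˡ-< (q * toℕ (hi y)) _ _) (+-monoʳ-< (q * toℕ (hi y)))

doubled : ∀ {p} {A : Set} → (Fin p → Bool → A) → Fin (p * 2) → A
doubled {p} F k = F (proj₁ (remQuot {p} 2 k)) (toBool (proj₂ (remQuot {p} 2 k)))

doubled-combine : ∀ {p} {A : Set} (F : Fin p → Bool → A) i b → doubled F (combine i (fromBool b)) ≡ F i b
doubled-combine {p} F i b =
  trans (cong (λ (j , c) → F j (toBool c)) (remQuot-combine {p} {2} i (fromBool b))) (cong (F i) (toBool-fromBool b))

-- Five orders need ⌊log₂ n⌋ members

a₀-on-one-side⇒¬partiallyShatters-5 : ∀ {n m} (S : Family n m) {a : Fin 3 → Fin n} → Distinct₃ a →
  (∀ i → pattern-of (S i) a 0F 1F ≡ pattern-of (S i) a 0F 2F) → ¬ PartiallyShatters S a 5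
a₀-on-one-side⇒¬partiallyShatters-5 S {a} distinct aligned sh@(g , _) =
  collision (pigeonhole (s≤s (s≤s (s≤s (s≤s (s≤s z≤n))))) code)
  where
  p₀₁ p₁₂ : Fin 5 → Bool
  p₀₁ k = pattern-of (S (g k)) a 0F 1F
  p₁₂ k = pattern-of (S (g k)) a 1F 2F
  code : Fin 5 → Fin 4
  code k = combine (fromBool (p₀₁ k)) (fromBool (p₁₂ k))
  collision : (∃₂ λ i j → toℕ i < toℕ j × code i ≡ code j) → ⊥
  collision (i , j , i<j , code≡) =
    shattering⇒sigs-differ S distinct sh (λ i≡j → <-irrefl (cong toℕ i≡j) i<j) sig≡
    where
    p₀₁≡ = fromBool-injective (combine-injectiveˡ (fromBool (p₀₁ i)) _ (fromBool (p₀₁ j)) _ code≡)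
    p₁₂≡ = fromBool-injective (combine-injectiveʳ (fromBool (p₀₁ i)) _ (fromBool (p₀₁ j)) _ code≡)
    sig≡ : sig (S (g i)) a ≡ sig (S (g j)) a
    sig≡ = cong₂ _,_ p₀₁≡ (cong₂ _,_ (trans (sym (aligned (g i))) (trans p₀₁≡ (aligned (g j)))) p₁₂≡)

indistinguishable-pair : ∀ {n m} (S : Family (suc n) m) → 2 ^ m < n →
  ∃₂ λ x y → toℕ x < toℕ y × ∀ i → precedes (S i) 0F (suc x) ≡ precedes (S i) 0F (suc y)
indistinguishable-pair S 2^m<n with pigeonhole 2^m<n (λ x → encode λ i → precedes (S i) 0F (suc x))
... | x , y , x<y , eq = x , y , x<y , encode-injective _ _ eq

shattersAll-five⇒⌊log₂n⌋≤m : ∀ {n m t} → 3 ≤ n → 5 ≤ t → (S : Family n m) → ShattersAll 3 S t → ⌊log₂ n ⌋ ≤ m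
shattersAll-five⇒⌊log₂n⌋≤m {suc n} {m} 3≤n 5≤t S sh = n<2^[1+k]⇒⌊log₂n⌋≤k m (suc n) (begin-strict
  suc n             <⟨ s≤s (s≤s n≤2^m) ⟩
  suc (suc (2 ^ m)) ≤⟨ +-mono-≤ 2≤2^m (≤-reflexive (sym (+-identityʳ (2 ^ m)))) ⟩
  2 ^ suc m         ∎)
  where
  open ≤-Reasoning
  2≤2^m : 2 ≤ 2 ^ m
  2≤2^m = ^-monoʳ-≤ 2 (≤-trans (s≤s z≤n) (≤-trans 5≤t (shattersAll⇒t≤m 3≤n S sh)))
  no-pair : 2 ^ m ≮ n
  no-pair 2^m<n with indistinguishable-pair S 2^m<n
  ... | x , y , x<y , aligned = a₀-on-one-side⇒¬partiallyShatters-5 S (increasing⇒distinct₃ a↑) aligned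
                                  (partiallyShatters-≤ S a 5≤t (sh a a↑))
    where
    a = triple 0F (suc x) (suc y)
    a↑ = triple-increasing {x = 0F} (s≤s z≤n) (s≤s x<y)
  n≤2^m : n ≤ 2 ^ m
  n≤2^m = ≮⇒≥ no-pair

order : Fin 6 → Sig
order 0F = true  , true  , true
order 1F = true  , true  , false
order 2F = false , true  , true
order 3F = false , false , true
order 4F = true  , false , false
order 5F = false , false , false

order-injective : ∀ {k l} → order k ≡ order l → k ≡ l
order-injective {k} {l} eq = trans (sym (index-order k)) (trans (cong index eq) (index-order l))
  where
  index : Sig → Fin 6
  index (true  , true  , true)  = 0F
  index (true  , true  , false) = 1F
  index (false , true  , true)  = 2F
  index (false , false , true)  = 3F
  index (true  , false , false) = 4F
  index (false , false , false) = 5F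
  index _                       = 0F
  index-order : ∀ k → index (order k) ≡ k
  index-order 0F = refl
  index-order 1F = refl
  index-order 2F = refl
  index-order 3F = refl
  index-order 4F = refl
  index-order 5F = refl

-- Junk value on the two cyclic signatures, which are never the signature of an ordering.
middle : Sig → Fin 3
middle (true  , true  , true)  = 1F
middle (true  , true  , false) = 2F
middle (false , true  , true)  = 0F
middle (false , false , true)  = 2F
middle (true  , false , false) = 0F
middle (false , false , false) = 1F
middle (true  , false , true)  = 0F
middle (false , true  , false) = 0F

-- The order putting p first (f = true) or last, and the other two elements increasing (c = true) or not.
endOrder : Fin 3 → Bool → Bool → Sig
endOrder 0F f c = f , f , c
endOrder 1F f c = not f , c , f
endOrder 2F f c = c , not f , not f

endOrder-cover : ∀ k p → middle (order k) ≢ p → ∃₂ λ f c → order k ≡ endOrder p f c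
endOrder-cover 0F 0F _ = true  , true  , refl
endOrder-cover 0F 2F _ = false , true  , refl
endOrder-cover 1F 0F _ = true  , false , refl
endOrder-cover 1F 1F _ = false , true  , refl
endOrder-cover 2F 1F _ = true  , true  , refl
endOrder-cover 2F 2F _ = false , false , refl
endOrder-cover 3F 0F _ = false , true  , refl
endOrder-cover 3F 1F _ = true  , false , refl
endOrder-cover 4F 1F _ = false , false , refl
endOrder-cover 4F 2F _ = true  , true  , refl
endOrder-cover 5F 0F _ = false , false , refl
endOrder-cover 5F 2F _ = true  , false , refl
endOrder-cover 0F 1F 1≢1 = ⊥-elim (1≢1 refl)
endOrder-cover 1F 2F 2≢2 = ⊥-elim (2≢2 refl)
endOrder-cover 2F 0F 0≢0 = ⊥-elim (0≢0 refl)
endOrder-cover 3F 2F 2≢2 = ⊥-elim (2≢2 refl)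
endOrder-cover 4F 0F 0≢0 = ⊥-elim (0≢0 refl)
endOrder-cover 5F 1F 1≢1 = ⊥-elim (1≢1 refl)

neg : Sig → Sig
neg (x , y , z) = not x , not y , not z

middle-neg : ∀ s → middle (neg s) ≡ middle s
middle-neg (true  , true  , true)  = refl
middle-neg (true  , true  , false) = refl
middle-neg (false , true  , true)  = refl
middle-neg (false , false , true)  = refl
middle-neg (true  , false , false) = refl
middle-neg (false , false , false) = refl
middle-neg (true  , false , true)  = refl
middle-neg (false , true  , false) = refl

s≢neg-s : ∀ s → s ≢ neg s
s≢neg-s (true  , _) ()
s≢neg-s (false , _) ()

-- Six orders from binary digits

orient : ∀ {n} → Bool → Fin n → Fin n
orient true  x = x
orient false x = opposite x

orient-injective : ∀ {n} d {x y : Fin n} → orient d x ≡ orient d y → x ≡ y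
orient-injective true  eq = eq
orient-injective false eq = opposite-injective eq

orient-<ᵇ : ∀ {n} d {x y : Fin n} → toℕ x < toℕ y → (toℕ (orient d x) <ᵇ toℕ (orient d y)) ≡ d
orient-<ᵇ true  x<y = <ᵇ≡true x<y
orient-<ᵇ false {x} {y} x<y = trans (opposite-<ᵇ x y) (<ᵇ≡false (<-asym x<y))

not-xor-not-xor : ∀ b f → not (b xor not (b xor f)) ≡ f
not-xor-not-xor false false = refl
not-xor-not-xor false true  = refl
not-xor-not-xor true  false = refl
not-xor-not-xor true  true  = refl

xor-≢ : ∀ {b c} e → b ≢ c → b xor e ≢ c xor e
xor-≢ {false} {false} _ b≢c = ⊥-elim (b≢c refl)
xor-≢ {false} {true}  e _   = not-¬ {e} refl
xor-≢ {true}  {false} e _   = λ eq → not-¬ {e} refl (sym eq)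
xor-≢ {true}  {true}  _ b≢c = ⊥-elim (b≢c refl)

Isolates : (Fin 3 → Bool) → Fin 3 → Set
Isolates β 0F = β 0F ≢ β 1F × β 1F ≡ β 2F
Isolates β 1F = β 0F ≢ β 1F × β 0F ≡ β 2F
Isolates β 2F = β 0F ≡ β 1F × β 1F ≢ β 2F

≢≢⇒≡ : ∀ {a b c : Bool} → a ≢ b → c ≢ b → a ≡ c
≢≢⇒≡ a≢b c≢b = trans (¬-not a≢b) (sym (¬-not c≢b))

-- A digit telling two of three elements apart isolates one of those two.
isolates-0∨1 : ∀ {β} → β 0F ≢ β 1F → Isolates β 0F ⊎ Isolates β 1F
isolates-0∨1 {β} ≢₀₁ with β 1F ≟ᵇ β 2F
... | yes ≡₁₂ = inj₁ (≢₀₁ , ≡₁₂)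
... | no  ≢₁₂ = inj₂ (≢₀₁ , ≢≢⇒≡ ≢₀₁ (≢₁₂ ∘ sym))

isolates-1∨2 : ∀ {β} → β 1F ≢ β 2F → Isolates β 1F ⊎ Isolates β 2F
isolates-1∨2 {β} ≢₁₂ with β 0F ≟ᵇ β 1F
... | yes ≡₀₁ = inj₂ (≡₀₁ , ≢₁₂)
... | no  ≢₀₁ = inj₁ (≢₀₁ , ≢≢⇒≡ ≢₀₁ (≢₁₂ ∘ sym))

isolates-0∨2 : ∀ {β} → β 0F ≢ β 2F → Isolates β 0F ⊎ Isolates β 2F
isolates-0∨2 {β} ≢₀₂ with β 1F ≟ᵇ β 2F
... | yes ≡₁₂ = inj₁ ((λ ≡₀₁ → ≢₀₂ (trans ≡₀₁ ≡₁₂)) , ≡₁₂)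
... | no  ≢₁₂ = inj₂ (≢≢⇒≡ ≢₀₂ ≢₁₂ , ≢₁₂)

two-isolated : ∀ {B} (β : Fin B → Fin 3 → Bool) → (∀ j k → j ≢ k → ∃ λ i → β i j ≢ β i k) →
               ∃₂ λ i p → ∃₂ λ i′ p′ → Isolates (β i) p × Isolates (β i′) p′ × p ≢ p′
two-isolated β separates
  with separates 0F 1F (λ ()) | separates 1F 2F (λ ()) | separates 0F 2F (λ ())
... | i , ≢₀₁ | i′ , ≢₁₂ | i″ , ≢₀₂
  with isolates-0∨1 {β i} ≢₀₁ | isolates-1∨2 {β i′} ≢₁₂ | isolates-0∨2 {β i″} ≢₀₂
... | inj₁ iso | inj₁ iso′ | _         = i , 0F , i′ , 1F , iso , iso′ , λ ()
... | inj₁ iso | inj₂ iso′ | _         = i , 0F , i′ , 2F , iso , iso′ , λ ()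
... | inj₂ iso | inj₂ iso′ | _         = i , 1F , i′ , 2F , iso , iso′ , λ ()
... | inj₂ iso | inj₁ _    | inj₁ iso″ = i , 1F , i″ , 0F , iso , iso″ , λ ()
... | inj₂ iso | inj₁ _    | inj₂ iso″ = i , 1F , i″ , 2F , iso , iso″ , λ ()

module DigitOrder {n} (digit : Fin n → Bool) (e d : Bool) where

  high : Fin n → Fin 2
  high x = fromBool (digit x xor e)

  key : Fin n → ℕ
  key = toℕ ∘ lex high (orient d)

  key-injective : ∀ {x y} → key x ≡ key y → x ≡ y
  key-injective eq = lex-injective high (orient d) (λ _ → orient-injective d) (toℕ-injective eq)

  key-<ᵇ-different : ∀ {x y} → digit x ≢ digit y → (key x <ᵇ key y) ≡ not (digit x xor e)
  key-<ᵇ-different x≢y = trans (lex-<ᵇ-high high (orient d) (λ eq → xor-≢ e x≢y (fromBool-injective eq)))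
                              (fromBool-<ᵇ (xor-≢ e x≢y))

  key-<ᵇ-same : ∀ {x y} → digit x ≡ digit y → toℕ x < toℕ y → (key x <ᵇ key y) ≡ d
  key-<ᵇ-same x≡y x<y = trans (lex-<ᵇ-low high (orient d) (cong (λ b → fromBool (b xor e)) x≡y)) (orient-<ᵇ d x<y)

  not-xor-flip : ∀ {x y} → digit x ≢ digit y → not (digit x xor e) ≡ not (not (digit y xor e))
  not-xor-flip {y = y} x≢y = cong not (trans (cong (_xor e) (¬-not x≢y)) (sym (not-distribˡ-xor (digit y) e)))

  keySig-isolated : (a : Fin 3 → Fin n) → StrictlyIncreasing a → ∀ p → Isolates (digit ∘ a) p →
                    keySig key a ≡ endOrder p (not (digit (a p) xor e)) d
  keySig-isolated a a↑ 0F (≢₀₁ , ≡₁₂) = cong₂ _,_ (key-<ᵇ-different ≢₀₁)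
    (cong₂ _,_ (key-<ᵇ-different (λ ≡₀₂ → ≢₀₁ (trans ≡₀₂ (sym ≡₁₂)))) (key-<ᵇ-same ≡₁₂ (a↑ 1F 2F (s≤s (s≤s z≤n)))))
  keySig-isolated a a↑ 1F (≢₀₁ , ≡₀₂) = cong₂ _,_ (trans (key-<ᵇ-different ≢₀₁) (not-xor-flip ≢₀₁))
    (cong₂ _,_ (key-<ᵇ-same ≡₀₂ (a↑ 0F 2F (s≤s z≤n))) (key-<ᵇ-different (λ ≡₁₂ → ≢₀₁ (trans ≡₀₂ (sym ≡₁₂)))))
  keySig-isolated a a↑ 2F (≡₀₁ , ≢₁₂) = cong₂ _,_ (key-<ᵇ-same ≡₀₁ (a↑ 0F 1F (s≤s z≤n)))
    (cong₂ _,_ (trans (key-<ᵇ-different ≢₀₂) (not-xor-flip ≢₀₂)) (trans (key-<ᵇ-different ≢₁₂) (not-xor-flip ≢₁₂)))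
    where ≢₀₂ = λ ≡₀₂ → ≢₁₂ (trans (sym ≡₀₁) ≡₀₂)

module DigitFamily {n} B (n≤2^B : n ≤ 2 ^ B) where

  digit : Fin B → Fin n → Bool
  digit i x = decode {B} (inject≤ x n≤2^B) i

  digits-separate : ∀ {x y} → x ≢ y → ∃ λ i → digit i x ≢ digit i y
  digits-separate x≢y = decode-separates {B} λ eq → x≢y (inject≤-injective n≤2^B n≤2^B _ _ eq)

  member : Fin B → Bool → Bool → Perm n
  member i e d = OrderedBy.ordering (DigitOrder.key (digit i) e d) (DigitOrder.key-injective (digit i) e d)

  family : Family n (B * 2 * 2)
  family = doubled (doubled member)

  family-at : ∀ i e d → family (combine (combine i (fromBool e)) (fromBool d)) ≡ member i e d
  family-at i e d = trans (doubled-combine (doubled member) _ d) (cong (λ F → F d) (doubled-combine member i e))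

  realise-order : (a : Fin 3 → Fin n) → StrictlyIncreasing a → ∀ {i} p → Isolates (digit i ∘ a) p →
                  ∀ k → middle (order k) ≢ p → ∃ λ l → sig (family l) a ≡ order k
  realise-order a a↑ {i} p iso k mid≢p with endOrder-cover k p mid≢p
  ... | f , c , order≡ = combine (combine i (fromBool e)) (fromBool c) , (begin
    sig (family _) a                              ≡⟨ cong (λ P → sig P a) (family-at i e c) ⟩
    sig (member i e c) a                          ≡⟨ sig-ordering _ (DigitOrder.key-injective (digit i) e c) a ⟩
    keySig (DigitOrder.key (digit i) e c) a       ≡⟨ DigitOrder.keySig-isolated (digit i) e c a a↑ p iso ⟩
    endOrder p (not (digit i (a p) xor e)) c      ≡⟨ cong (λ f′ → endOrder p f′ c) (not-xor-not-xor (digit i (a p)) f) ⟩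
    endOrder p f c                                ≡⟨ sym order≡ ⟩
    order k                                       ∎)
    where
    open ≡-Reasoning
    e = not (digit i (a p) xor f)

  shattersAll-six : ShattersAll 3 family 6
  shattersAll-six a a↑ with two-isolated (λ i j → digit i (a j)) separates
    where separates = λ j k j≢k → digits-separate (λ eq → j≢k (increasing-injective a↑ eq))
  ... | i , p , i′ , p′ , iso , iso′ , p≢p′ = shatters-by-realising family a order order-injective realise
    where
    realise : ∀ k → ∃ λ l → sig (family l) a ≡ order k
    realise k with middle (order k) ≟ᶠ p
    ... | no  mid≢p = realise-order a a↑ p iso k mid≢p
    ... | yes mid≡p = realise-order a a↑ p′ iso′ k λ mid≡p′ → p≢p′ (trans (sym mid≡p) mid≡p′)

-- Erdős–Szekeres

AllPairs-resp-⊆ : ∀ {X : Set} {R : X → X → Set} {xs ys : List X} → xs ⊆ ys → AllPairs R ys → AllPairs R xs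
AllPairs-resp-⊆ []             []         = []
AllPairs-resp-⊆ (y ∷ʳ xs⊆ys)   (_ ∷ rys)  = AllPairs-resp-⊆ xs⊆ys rys
AllPairs-resp-⊆ (refl ∷ xs⊆ys) (rx ∷ rys) = All-resp-⊆ xs⊆ys rx ∷ AllPairs-resp-⊆ xs⊆ys rys

length-filter-∁ : ∀ {X : Set} {P : X → Set} (P? : ∀ x → Dec (P x)) xs →
                  length (filter P? xs) + length (filter (λ x → ¬? (P? x)) xs) ≡ length xs
length-filter-∁ P? [] = refl
length-filter-∁ P? (x ∷ xs) with P? x
... | yes _ = cong suc (length-filter-∁ P? xs)
... | no  _ = trans (+-suc _ _) (cong suc (length-filter-∁ P? xs))

pigeonhole-sublist : ∀ {X : Set} (label : X → ℕ) s k (xs : List X) → All (λ x → label x < s) xs →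
                     s * k < length xs → ∃₂ λ c ys → ys ⊆ xs × All (λ y → label y ≡ c) ys × k < length ys
pigeonhole-sublist label zero k [] [] ()
pigeonhole-sublist label zero k (x ∷ xs) (() ∷ _) _
pigeonhole-sublist label (suc s) k xs below lt with k <? length (filter (λ x → label x ≟ s) xs)
... | yes big = s , _ , filter-⊆ (λ x → label x ≟ s) xs , all-filter (λ x → label x ≟ s) xs , big
... | no  small with pigeonhole-sublist label s k rest below-s rest-long
  where
  rest = filter (λ x → ¬? (label x ≟ s)) xs
  below-s : All (λ x → label x < s) rest
  below-s = All.zipWith (λ (x<1+s , x≢s) → ≤∧≢⇒< (≤-pred x<1+s) x≢s)
              (All.filter⁺ (λ x → ¬? (label x ≟ s)) below , all-filter (λ x → ¬? (label x ≟ s)) xs)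
  rest-long : s * k < length rest
  rest-long = +-cancelˡ-< k _ _ (begin-strict
    k + s * k                                            <⟨ lt ⟩
    length xs                                            ≡⟨ sym (length-filter-∁ (λ x → label x ≟ s) xs) ⟩
    length (filter (λ x → label x ≟ s) xs) + length rest ≤⟨ +-monoˡ-≤ _ (≮⇒≥ small) ⟩
    k + length rest                                      ∎)
    where open ≤-Reasoning
... | c , ys , ys⊆rest , labels , long = c , ys , ⊆-trans ys⊆rest (filter-⊆ _ xs) , labels , long

-- Labelling each entry by the length of a greedy increasing chain starting there makes labels drop
-- along increasing pairs, so entries with equal labels form decreasing sublists.
module ErdősSzekeres {X : Set} (κ : X → ℕ) where

  Increasing Decreasing : List X → Set
  Increasing = AllPairs (λ u v → κ u < κ v)
  Decreasing = AllPairs (λ u v → κ v < κ u)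

  longer : List X → List X → List X
  longer p q with length q ≤? length p
  ... | yes _ = p
  ... | no  _ = q

  longer-property : ∀ (P : List X → Set) p q → P p → P q → P (longer p q)
  longer-property P p q Pp Pq with length q ≤? length p
  ... | yes _ = Pp
  ... | no  _ = Pq

  length-longerˡ : ∀ p q → length p ≤ length (longer p q)
  length-longerˡ p q with length q ≤? length p
  ... | yes _   = ≤-refl
  ... | no  q≰p = <⇒≤ (≰⇒> q≰p)

  length-longerʳ : ∀ p q → length q ≤ length (longer p q)
  length-longerʳ p q with length q ≤? length p
  ... | yes q≤p = q≤p
  ... | no  _   = ≤-refl

  mutual
    chain : X → List X → List X
    chain x xs = x ∷ continuation x xs

    continuation : X → List X → List X
    continuation x []       = []
    continuation x (y ∷ ys) with κ x <? κ y
    ... | yes _ = longer (chain y ys) (continuation x ys)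
    ... | no  _ = continuation x ys

  mutual
    chain-⊆ : ∀ x xs → chain x xs ⊆ x ∷ xs
    chain-⊆ x xs = refl ∷ continuation-⊆ x xs

    continuation-⊆ : ∀ x ys → continuation x ys ⊆ ys
    continuation-⊆ x []       = []
    continuation-⊆ x (y ∷ ys) with κ x <? κ y
    ... | yes _ = longer-property (_⊆ y ∷ ys) _ _ (chain-⊆ y ys) (y ∷ʳ continuation-⊆ x ys)
    ... | no  _ = y ∷ʳ continuation-⊆ x ys

  chain-increasing : ∀ x ys → Increasing (chain x ys)
  chain-increasing x []       = [] ∷ []
  chain-increasing x (y ∷ ys) with κ x <? κ y
  ... | yes x<y = longer-property (λ l → Increasing (x ∷ l)) _ _ (prepend x<y (chain-increasing y ys))
                                  (chain-increasing x ys)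
    where
    prepend : ∀ {l} → κ x < κ y → Increasing (y ∷ l) → Increasing (x ∷ y ∷ l)
    prepend x<y inc@(y< ∷ _) = (x<y ∷ All.map (<-trans x<y) y<) ∷ inc
  ... | no  _   = chain-increasing x ys

  labelled : List X → List (X × ℕ)
  labelled []       = []
  labelled (x ∷ xs) = (x , length (chain x xs)) ∷ labelled xs

  map-proj₁-labelled : ∀ xs → map proj₁ (labelled xs) ≡ xs
  map-proj₁-labelled []       = refl
  map-proj₁-labelled (x ∷ xs) = cong (x ∷_) (map-proj₁-labelled xs)

  continuation-bounds-labels : ∀ x ys →
    All (λ q → κ x < κ (proj₁ q) → proj₂ q ≤ length (continuation x ys)) (labelled ys)
  continuation-bounds-labels x []       = []
  continuation-bounds-labels x (y ∷ ys) with κ x <? κ y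
  ... | yes _   = (λ _ → length-longerˡ (chain y ys) (continuation x ys)) ∷
                  All.map (λ bound x<z → ≤-trans (bound x<z) (length-longerʳ (chain y ys) (continuation x ys)))
                          (continuation-bounds-labels x ys)
  ... | no  x≮y = (λ x<y → ⊥-elim (x≮y x<y)) ∷ continuation-bounds-labels x ys

  labels-decrease : ∀ xs → AllPairs (λ p q → κ (proj₁ p) < κ (proj₁ q) → proj₂ q < proj₂ p) (labelled xs)
  labels-decrease []       = []
  labels-decrease (x ∷ xs) = All.map (λ bound x<y → s≤s (bound x<y)) (continuation-bounds-labels x xs) ∷
                             labels-decrease xs

  long-chain-or-short-labels : ∀ s xs → (∃ λ ys → ys ⊆ xs × s ≤ length ys × Increasing ys) ⊎
                                         All (λ q → proj₂ q < s) (labelled xs)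
  long-chain-or-short-labels s []       = inj₂ []
  long-chain-or-short-labels s (x ∷ xs) with s ≤? length (chain x xs) | long-chain-or-short-labels s xs
  ... | yes long  | _                               = inj₁ (chain x xs , chain-⊆ x xs , long , chain-increasing x xs)
  ... | no  _     | inj₁ (ys , ys⊆xs , long , inc) = inj₁ (ys , x ∷ʳ ys⊆xs , long , inc)
  ... | no  short | inj₂ shorts                     = inj₂ (≰⇒> short ∷ shorts)

  equal-labels⇒decreasing : ∀ {c} zs → All (λ q → proj₂ q ≡ c) zs →
    AllPairs (λ p q → κ (proj₁ p) < κ (proj₁ q) → proj₂ q < proj₂ p) zs →
    AllPairs (λ p q → κ (proj₁ p) ≢ κ (proj₁ q)) zs → Decreasing (map proj₁ zs)
  equal-labels⇒decreasing []       []         []         []         = []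
  equal-labels⇒decreasing {c} (z ∷ zs) (z≡c ∷ ≡c) (dec ∷ decs) (dist ∷ dists) =
    All.map⁺ (All.zipWith decreasing (All.zip (≡c , dec) , dist)) ∷ equal-labels⇒decreasing zs ≡c decs dists
    where
    decreasing : ∀ {q} → (proj₂ q ≡ c × (κ (proj₁ z) < κ (proj₁ q) → proj₂ q < proj₂ z)) × (κ (proj₁ z) ≢ κ (proj₁ q)) →
                 κ (proj₁ q) < κ (proj₁ z)
    decreasing {q} ((q≡c , dec) , z≢q) with <-cmp (κ (proj₁ z)) (κ (proj₁ q))
    ... | tri< z<q _ _ = ⊥-elim (<-irrefl (trans q≡c (sym z≡c)) (dec z<q))
    ... | tri≈ _ z≡q _ = ⊥-elim (z≢q z≡q)
    ... | tri> _ _ q<z = q<z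

  erdős-szekeres : ∀ s xs → AllPairs (λ u v → κ u ≢ κ v) xs → s * s ≤ length xs →
                   ∃ λ ys → ys ⊆ xs × s ≤ length ys × (Increasing ys ⊎ Decreasing ys)
  erdős-szekeres zero    xs _        _    = [] , minimum xs , z≤n , inj₁ []
  erdős-szekeres s@(suc s-1) xs distinct long with long-chain-or-short-labels s xs
  ... | inj₁ (ys , ys⊆xs , long-ys , inc) = ys , ys⊆xs , long-ys , inj₁ inc
  ... | inj₂ short with pigeonhole-sublist proj₂ s s-1 (labelled xs) short s*[s-1]<length
    where
    s*[s-1]<length : s * s-1 < length (labelled xs)
    s*[s-1]<length = <-≤-trans (*-monoʳ-< s ≤-refl)
      (subst (s * s ≤_) (trans (cong length (sym (map-proj₁-labelled xs))) (length-map proj₁ (labelled xs))) long)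
  ... | c , zs , zs⊆ , equal , long-zs =
    map proj₁ zs , subst (map proj₁ zs ⊆_) (map-proj₁-labelled xs) (map⁺ proj₁ zs⊆) ,
    subst (s ≤_) (sym (length-map proj₁ zs)) long-zs ,
    inj₂ (equal-labels⇒decreasing zs equal (AllPairs-resp-⊆ zs⊆ (labels-decrease xs))
           (AllPairs-resp-⊆ zs⊆ (AllPairs.map⁻ (subst (AllPairs _) (sym (map-proj₁-labelled xs)) distinct))))

-- Three orders need log log n members

tower : ℕ → ℕ
tower zero    = 3
tower (suc m) = tower m * tower m

tower≤2^2^[1+m] : ∀ m → tower m ≤ 2 ^ (2 ^ suc m)
tower≤2^2^[1+m] zero    = s≤s (s≤s (s≤s z≤n))
tower≤2^2^[1+m] (suc m) = subst (tower m * tower m ≤_) 2^k*2^k≡2^[k+k]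
  (*-mono-≤ (tower≤2^2^[1+m] m) (tower≤2^2^[1+m] m))
  where
  k = 2 ^ suc m
  2^k*2^k≡2^[k+k] : 2 ^ k * 2 ^ k ≡ 2 ^ (2 ^ suc (suc m))
  2^k*2^k≡2^[k+k] = trans (sym (^-distribˡ-+-* 2 k k)) (cong (λ e → 2 ^ (k + e)) (sym (+-identityʳ k)))

monotone-for-all : ∀ {X : Set} m (keys : Fin m → X → ℕ) (xs : List X) →
  (∀ i → AllPairs (λ u v → keys i u ≢ keys i v) xs) → tower m ≤ length xs →
  ∃ λ ys → ys ⊆ xs × 3 ≤ length ys ×
           (∀ i → ErdősSzekeres.Increasing (keys i) ys ⊎ ErdősSzekeres.Decreasing (keys i) ys)
monotone-for-all zero    keys xs _        long = xs , ⊆-refl , long , λ ()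
monotone-for-all (suc m) keys xs distinct long
  with ErdősSzekeres.erdős-szekeres (keys 0F) (tower m) xs (distinct 0F) long
... | ys , ys⊆xs , long-ys , mono₀
  with monotone-for-all m (keys ∘ suc) ys (λ i → AllPairs-resp-⊆ ys⊆xs (distinct (suc i))) long-ys
... | zs , zs⊆ys , long-zs , monos = zs , ⊆-trans zs⊆ys ys⊆xs , long-zs , mono
  where
  mono : ∀ i → ErdősSzekeres.Increasing (keys i) zs ⊎ ErdősSzekeres.Decreasing (keys i) zs
  mono 0F       = Sum.map (AllPairs-resp-⊆ zs⊆ys) (AllPairs-resp-⊆ zs⊆ys) mono₀
  mono (suc i) = monos i

monotone⇒¬partiallyShatters-3 : ∀ {n m} (S : Family n m) {a : Fin 3 → Fin n} → Distinct₃ a →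
  (∀ i → ∃ λ b → sig (S i) a ≡ (b , b , b)) → ¬ PartiallyShatters S a 3
monotone⇒¬partiallyShatters-3 S {a} distinct monotone sh@(g , _) =
  collision (pigeonhole (s≤s (s≤s (s≤s z≤n))) (fromBool ∘ proj₁ ∘ monotone ∘ g))
  where
  collision : (∃₂ λ i j → toℕ i < toℕ j × fromBool (proj₁ (monotone (g i))) ≡ fromBool (proj₁ (monotone (g j)))) → ⊥
  collision (i , j , i<j , eq) = shattering⇒sigs-differ S distinct sh (λ i≡j → <-irrefl (cong toℕ i≡j) i<j)
    (trans (proj₂ (monotone (g i))) (trans (cong (λ b → b , b , b) (fromBool-injective eq)) (sym (proj₂ (monotone (g j))))))

shattersAll-three⇒loglog≤m : ∀ {n m t} → 3 ≤ t → (S : Family n m) → ShattersAll 3 S t → loglog n ≤ m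
shattersAll-three⇒loglog≤m {n} {m} 3≤t S sh = ≤-pred (n<2^k⇒⌊log₂n⌋<k ⌊log₂ n ⌋ (s≤s z≤n)
  (n<2^k⇒⌊log₂n⌋<k n (m^n>0 2 (suc m)) (<-≤-trans (≰⇒> no-monotone-triple) (tower≤2^2^[1+m] m))))
  where
  positions = λ i → pos (S i)
  increasing : AllPairs (λ x y → toℕ x < toℕ y) (allFin n)
  increasing = AllPairs.tabulate⁺-< (λ i<j → i<j)
  no-monotone-triple : ¬ (tower m ≤ n)
  no-monotone-triple long with monotone-for-all m positions (allFin n)
    (λ i → AllPairs.map (λ x<y eq → <-irrefl (cong toℕ (pos-injective (S i) eq)) x<y) increasing)
    (subst (tower m ≤_) (sym (length-tabulate id)) long)
  ... | []        , _ , ()                 , _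
  ... | _ ∷ []     , _ , s≤s ()             , _
  ... | _ ∷ _ ∷ [] , _ , s≤s (s≤s ())       , _
  ... | x ∷ y ∷ z ∷ _ , xyz⊆ , _ , monos = monotone⇒¬partiallyShatters-3 S (increasing⇒distinct₃ a↑) monotone
                                               (partiallyShatters-≤ S a 3≤t (sh a a↑))
    where
    a = triple x y z
    a↑ : StrictlyIncreasing a
    a↑ with AllPairs-resp-⊆ xyz⊆ increasing
    ... | (x<y ∷ _ ∷ _) ∷ (y<z ∷ _) ∷ _ = triple-increasing x<y y<z
    monotone : ∀ i → ∃ λ b → sig (S i) a ≡ (b , b , b)
    monotone i with monos i
    ... | inj₁ ((x<y ∷ x<z ∷ _) ∷ (y<z ∷ _) ∷ _) = true , cong₂ _,_ (<ᵇ≡true x<y) (cong₂ _,_ (<ᵇ≡true x<z) (<ᵇ≡true y<z))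
    ... | inj₂ ((y<x ∷ z<x ∷ _) ∷ (z<y ∷ _) ∷ _) =
      false , cong₂ _,_ (<ᵇ≡false (<-asym y<x)) (cong₂ _,_ (<ᵇ≡false (<-asym z<x)) (<ᵇ≡false (<-asym z<y)))

-- Four orders by iterated squaring

keySig-opposite : ∀ {n p} (κ : Fin n → Fin p) {a} → Distinct₃ (κ ∘ a) →
                  keySig (toℕ ∘ opposite ∘ κ) a ≡ neg (keySig (toℕ ∘ κ) a)
keySig-opposite κ {a} (≢₀₁ , ≢₀₂ , ≢₁₂) = cong₂ _,_ (flipped ≢₀₁) (cong₂ _,_ (flipped ≢₀₂) (flipped ≢₁₂))
  where
  flipped : ∀ {x y} → κ x ≢ κ y → (toℕ (opposite (κ x)) <ᵇ toℕ (opposite (κ y))) ≡ not (toℕ (κ x) <ᵇ toℕ (κ y))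
  flipped {x} {y} κx≢κy = trans (opposite-<ᵇ (κ x) (κ y)) (<ᵇ-flip (κx≢κy ∘ toℕ-injective))

keySig-lex-high : ∀ {n p q} (hi : Fin n → Fin p) (lo : Fin n → Fin q) {a} → Distinct₃ (hi ∘ a) →
                  keySig (toℕ ∘ lex hi lo) a ≡ keySig (toℕ ∘ hi) a
keySig-lex-high hi lo (≢₀₁ , ≢₀₂ , ≢₁₂) =
  cong₂ _,_ (lex-<ᵇ-high hi lo ≢₀₁) (cong₂ _,_ (lex-<ᵇ-high hi lo ≢₀₂) (lex-<ᵇ-high hi lo ≢₁₂))

keySig-lex-low : ∀ {n p q} (hi : Fin n → Fin p) (lo : Fin n → Fin q) {a} → hi (a 0F) ≡ hi (a 1F) → hi (a 1F) ≡ hi (a 2F) →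
                 keySig (toℕ ∘ lex hi lo) a ≡ keySig (toℕ ∘ lo) a
keySig-lex-low hi lo ≡₀₁ ≡₁₂ =
  cong₂ _,_ (lex-<ᵇ-low hi lo ≡₀₁) (cong₂ _,_ (lex-<ᵇ-low hi lo (trans ≡₀₁ ≡₁₂)) (lex-<ᵇ-low hi lo ≡₁₂))

middle-flip₀₁ : ∀ d c → middle (d , c , c) ≢ middle (not d , c , c)
middle-flip₀₁ true  true  ()
middle-flip₀₁ true  false ()
middle-flip₀₁ false true  ()
middle-flip₀₁ false false ()

middle-flip₀₂ : ∀ c d → middle (c , d , not c) ≢ middle (c , not d , not c)
middle-flip₀₂ true  true  ()
middle-flip₀₂ true  false ()
middle-flip₀₂ false true  ()
middle-flip₀₂ false false ()

middle-flip₁₂ : ∀ c d → middle (c , c , d) ≢ middle (c , c , not d)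
middle-flip₁₂ true  true  ()
middle-flip₁₂ true  false ()
middle-flip₁₂ false true  ()
middle-flip₁₂ false false ()

squares : ℕ → ℕ
squares zero    = 2
squares (suc r) = squares r * squares r

squares≡2^2^r : ∀ r → squares r ≡ 2 ^ (2 ^ r)
squares≡2^2^r zero    = refl
squares≡2^2^r (suc r) = trans (cong₂ _*_ (squares≡2^2^r r) (squares≡2^2^r r))
  (trans (sym (^-distribˡ-+-* 2 (2 ^ r) (2 ^ r))) (cong (λ e → 2 ^ (2 ^ r + e)) (sym (+-identityʳ (2 ^ r)))))

opaque
  quotient remainder : ∀ {s} → Fin (s * s) → Fin s
  quotient  {s} z = proj₁ (remQuot {s} s z)
  remainder {s} z = proj₂ (remQuot {s} s z)

  quotient-remainder-injective : ∀ {s} {z w : Fin (s * s)} →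
                                 quotient {s} z ≡ quotient w → remainder {s} z ≡ remainder w → z ≡ w
  quotient-remainder-injective {s} {z} {w} q≡ r≡ =
    trans (sym (combine-remQuot {s} s z)) (trans (cong₂ combine q≡ r≡) (combine-remQuot {s} s w))

square : ∀ {s} → (Fin s → Fin s) → (Fin s → Fin s) → Fin (s * s) → Fin (s * s)
square {s} k₁ k₂ = lex (k₁ ∘ quotient {s}) (k₂ ∘ remainder {s})

square-injective : ∀ {s} {k₁ k₂ : Fin s → Fin s} → (∀ {x y} → k₁ x ≡ k₁ y → x ≡ y) → (∀ {x y} → k₂ x ≡ k₂ y → x ≡ y) →
                   ∀ {z w} → square k₁ k₂ z ≡ square k₁ k₂ w → z ≡ w
square-injective {s} {k₁} {k₂} k₁-injective k₂-injective =
  lex-injective (k₁ ∘ quotient {s}) (k₂ ∘ remainder {s}) λ q≡ r≡ →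
    quotient-remainder-injective (k₁-injective q≡) (k₂-injective r≡)

-- Members 0 and 1 of level r + 1 order blocks by quotient and then by remainder, increasingly or decreasingly;
-- member i + 2 applies member i of level r to quotient and remainder alike.
keys : ∀ r → Fin (r * 2) → Fin (squares r) → Fin (squares r)
keys (suc r) 0F            = square {squares r} id id
keys (suc r) 1F            = square {squares r} id opposite
keys (suc r) (suc (suc i)) = square (keys r i) (keys r i)

keys-injective : ∀ r i {x y} → keys r i x ≡ keys r i y → x ≡ y
keys-injective (suc r) 0F            = square-injective {squares r} id id
keys-injective (suc r) 1F            = square-injective {squares r} id opposite-injective
keys-injective (suc r) (suc (suc i)) = square-injective (keys-injective r i) (keys-injective r i)

module Blocks {s} (a : Fin 3 → Fin (s * s)) where

  q ρ : Fin 3 → Fin s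
  q j = quotient (a j)
  ρ j = remainder (a j)

  ascending descending : Fin (s * s) → ℕ
  ascending  = toℕ ∘ square {s} id id
  descending = toℕ ∘ square {s} id opposite

  across : ∀ {j k} → q j ≢ q k → (ascending (a j) <ᵇ ascending (a k)) ≡ (toℕ (q j) <ᵇ toℕ (q k)) ×
                                  (descending (a j) <ᵇ descending (a k)) ≡ (toℕ (q j) <ᵇ toℕ (q k))
  across qj≢qk = lex-<ᵇ-high (quotient {s}) (remainder {s}) qj≢qk , lex-<ᵇ-high (quotient {s}) (opposite ∘ remainder {s}) qj≢qk

  within : ∀ {j k} → a j ≢ a k → q j ≡ q k → (ascending (a j) <ᵇ ascending (a k)) ≡ (toℕ (ρ j) <ᵇ toℕ (ρ k)) ×
                                             (descending (a j) <ᵇ descending (a k)) ≡ not (toℕ (ρ j) <ᵇ toℕ (ρ k))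
  within {j} {k} aj≢ak qj≡qk =
    lex-<ᵇ-low (quotient {s}) (remainder {s}) qj≡qk ,
    trans (lex-<ᵇ-low (quotient {s}) (opposite ∘ remainder {s}) qj≡qk)
          (trans (opposite-<ᵇ (ρ j) (ρ k)) (<ᵇ-flip (λ ρj≡ρk → aj≢ak (quotient-remainder-injective qj≡qk (toℕ-injective ρj≡ρk)))))

  -- Reversing the offsets swaps the two elements sharing a block, which are adjacent in both orders.
  middles-differ-by-reversing-a-block : Distinct₃ a → ¬ (q 0F ≡ q 1F × q 1F ≡ q 2F) → ¬ Distinct₃ q →
    middle (keySig ascending a) ≢ middle (keySig descending a)
  middles-differ-by-reversing-a-block (≢₀₁ , ≢₀₂ , ≢₁₂) not-one-block not-three-blocks
    with q 0F ≟ᶠ q 1F | q 0F ≟ᶠ q 2F | q 1F ≟ᶠ q 2F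
  ... | yes e₀₁ | yes e₀₂ | _      = ⊥-elim (not-one-block (e₀₁ , trans (sym e₀₁) e₀₂))
  ... | yes e₀₁ | no _    | yes e₁₂ = ⊥-elim (not-one-block (e₀₁ , e₁₂))
  ... | no _    | yes e₀₂ | yes e₁₂ = ⊥-elim (not-one-block (trans e₀₂ (sym e₁₂) , e₁₂))
  ... | no n₀₁  | no n₀₂  | no n₁₂  = ⊥-elim (not-three-blocks (n₀₁ , n₀₂ , n₁₂))
  ... | yes e₀₁ | no n₀₂  | no n₁₂  = λ eq → middle-flip₀₁ _ _ (trans (cong middle (sym asc)) (trans eq (cong middle desc)))
    where
    c≡ = cong (λ x → toℕ x <ᵇ toℕ (q 2F)) (sym e₀₁)
    asc  = cong₂ _,_ (proj₁ (within ≢₀₁ e₀₁)) (cong₂ _,_ (proj₁ (across n₀₂)) (trans (proj₁ (across n₁₂)) c≡))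
    desc = cong₂ _,_ (proj₂ (within ≢₀₁ e₀₁)) (cong₂ _,_ (proj₂ (across n₀₂)) (trans (proj₂ (across n₁₂)) c≡))
  ... | no n₀₁  | yes e₀₂ | no n₁₂  = λ eq → middle-flip₀₂ _ _ (trans (cong middle (sym asc)) (trans eq (cong middle desc)))
    where
    c≡ = trans (cong (λ x → toℕ (q 1F) <ᵇ toℕ x) (sym e₀₂)) (<ᵇ-flip (n₀₁ ∘ toℕ-injective))
    asc  = cong₂ _,_ (proj₁ (across n₀₁)) (cong₂ _,_ (proj₁ (within ≢₀₂ e₀₂)) (trans (proj₁ (across n₁₂)) c≡))
    desc = cong₂ _,_ (proj₂ (across n₀₁)) (cong₂ _,_ (proj₂ (within ≢₀₂ e₀₂)) (trans (proj₂ (across n₁₂)) c≡))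
  ... | no n₀₁  | no n₀₂  | yes e₁₂ = λ eq → middle-flip₁₂ _ _ (trans (cong middle (sym asc)) (trans eq (cong middle desc)))
    where
    c≡ = cong (λ x → toℕ (q 0F) <ᵇ toℕ x) (sym e₁₂)
    asc  = cong₂ _,_ (proj₁ (across n₀₁)) (cong₂ _,_ (trans (proj₁ (across n₀₂)) c≡) (proj₁ (within ≢₁₂ e₁₂)))
    desc = cong₂ _,_ (proj₂ (across n₀₁)) (cong₂ _,_ (trans (proj₂ (across n₀₂)) c≡) (proj₂ (within ≢₁₂ e₁₂)))

MiddlesDiffer : ℕ → Set
MiddlesDiffer r = ∀ (a : Fin 3 → Fin (squares r)) → Distinct₃ a →
  ∃₂ λ i j → middle (keySig (toℕ ∘ keys r i) a) ≢ middle (keySig (toℕ ∘ keys r j) a)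

middles-differ-lift : ∀ r {a : Fin 3 → Fin (squares (suc r))} {b} →
  (∀ i → keySig (toℕ ∘ keys (suc r) (suc (suc i))) a ≡ keySig (toℕ ∘ keys r i) b) →
  (∃₂ λ i j → middle (keySig (toℕ ∘ keys r i) b) ≢ middle (keySig (toℕ ∘ keys r j) b)) →
  ∃₂ λ i j → middle (keySig (toℕ ∘ keys (suc r) i) a) ≢ middle (keySig (toℕ ∘ keys (suc r) j) a)
middles-differ-lift r lifted (i , j , differ) =
  suc (suc i) , suc (suc j) , λ eq → differ (trans (cong middle (sym (lifted i))) (trans eq (cong middle (lifted j))))

middles-differ : ∀ r → MiddlesDiffer r
middles-differ zero a (≢₀₁ , ≢₀₂ , ≢₁₂) = ⊥-elim (no-three-in-two (a 0F) (a 1F) (a 2F) ≢₀₁ ≢₀₂ ≢₁₂)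
  where
  no-three-in-two : ∀ (x y z : Fin 2) → x ≢ y → x ≢ z → y ≢ z → ⊥
  no-three-in-two 0F 0F _  x≢y _   _   = x≢y refl
  no-three-in-two 1F 1F _  x≢y _   _   = x≢y refl
  no-three-in-two 0F 1F 0F _   x≢z _   = x≢z refl
  no-three-in-two 0F 1F 1F _   _   y≢z = y≢z refl
  no-three-in-two 1F 0F 0F _   _   y≢z = y≢z refl
  no-three-in-two 1F 0F 1F _   x≢z _   = x≢z refl
middles-differ (suc r) a distinct@(≢₀₁ , ≢₀₂ , ≢₁₂) with distinct₃? (quotient ∘ a) | quotient (a 0F) ≟ᶠ quotient (a 1F) ×-dec quotient (a 1F) ≟ᶠ quotient (a 2F)
... | yes three-blocks | _ = middles-differ-lift r {a} {quotient ∘ a} (λ i →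
  keySig-lex-high (keys r i ∘ quotient) (keys r i ∘ remainder) {a} (distinct₃-map (keys-injective r i) {quotient ∘ a} three-blocks))
  (middles-differ r (quotient ∘ a) three-blocks)
... | no _ | yes (e₀₁ , e₁₂) = middles-differ-lift r {a} {remainder ∘ a} (λ i →
  keySig-lex-low (keys r i ∘ quotient) (keys r i ∘ remainder) {a} (cong (keys r i) e₀₁) (cong (keys r i) e₁₂))
  (middles-differ r (remainder ∘ a) remainders-distinct)
  where
  remainders-distinct : Distinct₃ (remainder ∘ a)
  remainders-distinct = (λ ρ≡ → ≢₀₁ (quotient-remainder-injective e₀₁ ρ≡)) ,
                        (λ ρ≡ → ≢₀₂ (quotient-remainder-injective (trans e₀₁ e₁₂) ρ≡)) ,
                        (λ ρ≡ → ≢₁₂ (quotient-remainder-injective e₁₂ ρ≡))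
... | no not-three | no not-one = 0F , 1F , Blocks.middles-differ-by-reversing-a-block a distinct not-one not-three

withNegations : Sig → Sig → Fin 4 → Sig
withNegations σ σ′ 0F = σ
withNegations σ σ′ 1F = neg σ
withNegations σ σ′ 2F = σ′
withNegations σ σ′ 3F = neg σ′

withNegations-injective : ∀ {σ σ′} → middle σ ≢ middle σ′ → ∀ {k l} → withNegations σ σ′ k ≡ withNegations σ σ′ l → k ≡ l
withNegations-injective {σ} {σ′} differ = distinguish _ _
  where
  middles : ∀ {x y} → middle x ≡ middle σ → middle y ≡ middle σ′ → x ≢ y
  middles {x} {y} mx my x≡y = differ (trans (sym mx) (trans (cong middle x≡y) my))
  distinguish : ∀ k l → withNegations σ σ′ k ≡ withNegations σ σ′ l → k ≡ l
  distinguish 0F 0F _  = refl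
  distinguish 1F 1F _  = refl
  distinguish 2F 2F _  = refl
  distinguish 3F 3F _  = refl
  distinguish 0F 1F eq = ⊥-elim (s≢neg-s σ eq)
  distinguish 1F 0F eq = ⊥-elim (s≢neg-s σ (sym eq))
  distinguish 2F 3F eq = ⊥-elim (s≢neg-s σ′ eq)
  distinguish 3F 2F eq = ⊥-elim (s≢neg-s σ′ (sym eq))
  distinguish 0F 2F eq = ⊥-elim (middles refl refl eq)
  distinguish 0F 3F eq = ⊥-elim (middles refl (middle-neg σ′) eq)
  distinguish 1F 2F eq = ⊥-elim (middles (middle-neg σ) refl eq)
  distinguish 1F 3F eq = ⊥-elim (middles (middle-neg σ) (middle-neg σ′) eq)
  distinguish 2F 0F eq = ⊥-elim (middles refl refl (sym eq))
  distinguish 3F 0F eq = ⊥-elim (middles refl (middle-neg σ′) (sym eq))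
  distinguish 2F 1F eq = ⊥-elim (middles (middle-neg σ) refl (sym eq))
  distinguish 3F 1F eq = ⊥-elim (middles (middle-neg σ) (middle-neg σ′) (sym eq))

module SquaringFamily {n} r (n≤squares : n ≤ squares r) where

  embed : Fin n → Fin (squares r)
  embed x = inject≤ x n≤squares

  key : Fin (r * 2) → Bool → Fin n → ℕ
  key i o = toℕ ∘ orient o ∘ keys r i ∘ embed

  key-injective : ∀ i o {x y} → key i o x ≡ key i o y → x ≡ y
  key-injective i o eq =
    inject≤-injective n≤squares n≤squares _ _ (keys-injective r i (orient-injective o (toℕ-injective eq)))

  member : Fin (r * 2) → Bool → Perm n
  member i o = OrderedBy.ordering (key i o) (key-injective i o)

  family : Family n (r * 2 * 2)
  family = doubled member

  sig-member : ∀ i o (a : Fin 3 → Fin n) → Distinct₃ a →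
               sig (family (combine i (fromBool o))) a ≡ (if o then id else neg) (keySig (toℕ ∘ keys r i) (embed ∘ a))
  sig-member i o a distinct = trans (cong (λ P → sig P a) (doubled-combine member i o))
    (trans (sig-ordering (key i o) (key-injective i o) a) (oriented o))
    where
    oriented : ∀ o → keySig (key i o) a ≡ (if o then id else neg) (keySig (toℕ ∘ keys r i) (embed ∘ a))
    oriented true  = refl
    oriented false = keySig-opposite (keys r i ∘ embed) {a}
      (distinct₃-map (λ eq → inject≤-injective n≤squares n≤squares _ _ (keys-injective r i eq)) {a} distinct)

  shattersAll-four : ShattersAll 3 family 4
  shattersAll-four a a↑ with middles-differ r (embed ∘ a) (distinct₃-map (inject≤-injective n≤squares n≤squares _ _) {a} distinct)
    where distinct = increasing⇒distinct₃ a↑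
  ... | i , j , differ = shatters-by-realising family a _ (withNegations-injective differ) realise
    where
    distinct = increasing⇒distinct₃ a↑
    realise : ∀ k → ∃ λ l → sig (family l) a ≡
                            withNegations (keySig (toℕ ∘ keys r i) (embed ∘ a)) (keySig (toℕ ∘ keys r j) (embed ∘ a)) k
    realise 0F = _ , sig-member i true  a distinct
    realise 1F = _ , sig-member i false a distinct
    realise 2F = _ , sig-member j true  a distinct
    realise 3F = _ , sig-member j false a distinct

[1+L]*2*2≤8*L : ∀ L → 1 ≤ L → suc L * 2 * 2 ≤ 8 * L
[1+L]*2*2≤8*L 1             _ = ≤-refl
[1+L]*2*2≤8*L (suc (suc L)) _ = subst (suc (suc (suc L)) * 2 * 2 ≤_) (sym (*-suc 8 (suc L)))
  (+-mono-≤ {4} {8} (s≤s (s≤s (s≤s (s≤s z≤n)))) ([1+L]*2*2≤8*L (suc L) (s≤s z≤n)))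

Θ-by-sandwich : ∀ {t} (h : ℕ → ℕ) N →
  (∀ {n m} → N ≤ n → (S : Family n m) → ShattersAll 3 S t → h n ≤ m) →
  (∀ n → N ≤ n → 1 ≤ h n × Σ (Family n (suc (h n) * 2 * 2)) λ S → ShattersAll 3 S t) →
  IsΘ 3 t h
Θ-by-sandwich {t} h N lower upper = 1 , 8 , N , ≤-refl , λ n N≤n →
  bounds n N≤n (proj₁ (upper n N≤n)) (shattersAll⇒f≤m (proj₁ (proj₂ (upper n N≤n))) (proj₂ (proj₂ (upper n N≤n))))
  where
  bounds : ∀ n → N ≤ n → 1 ≤ h n → (∃ λ f → IsF 3 n t f × f ≤ suc (h n) * 2 * 2) →
           ∃ λ f → IsF 3 n t f × h n ≤ 1 * f × f ≤ 8 * h n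
  bounds n N≤n 1≤h (f , isF , f≤) = f , isF , h≤f , ≤-trans f≤ ([1+L]*2*2≤8*L (h n) 1≤h)
    where
    h≤f : h n ≤ 1 * f
    h≤f with proj₁ isF
    ... | optimal , _ , optimal-shatters = subst (h n ≤_) (sym (*-identityˡ f)) (lower N≤n optimal optimal-shatters)

f≡Θloglog-for-t∈3,4 : (t : ℕ) → 3 ≤ t → t ≤ 4 → IsΘ 3 t loglog
f≡Θloglog-for-t∈3,4 t 3≤t t≤4 = Θ-by-sandwich loglog 4
  (λ _ S sh → shattersAll-three⇒loglog≤m 3≤t S sh)
  λ n 4≤n → 2^k≤n⇒k≤⌊log₂n⌋ 1 (2^k≤n⇒k≤⌊log₂n⌋ 2 4≤n) ,
            Squaring.family n , shattersAll-≤ (Squaring.family n) t≤4 (Squaring.shattersAll-four n)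
  where
  n≤squares[1+loglog] : ∀ n → n ≤ squares (suc (loglog n))
  n≤squares[1+loglog] n = subst (n ≤_) (sym (squares≡2^2^r (suc (loglog n))))
    (≤-trans (<⇒≤ (n<2^[1+⌊log₂n⌋] n)) (^-monoʳ-≤ 2 (n<2^[1+⌊log₂n⌋] ⌊log₂ n ⌋)))
  module Squaring n = SquaringFamily {n} (suc (loglog n)) (n≤squares[1+loglog] n)

f≡Θ⌊log₂⌋-for-t∈5,6 : (t : ℕ) → 5 ≤ t → t ≤ 6 → IsΘ 3 t (λ n → ⌊log₂ n ⌋)
f≡Θ⌊log₂⌋-for-t∈5,6 t 5≤t t≤6 = Θ-by-sandwich (λ n → ⌊log₂ n ⌋) 3
  (λ 3≤n S sh → shattersAll-five⇒⌊log₂n⌋≤m 3≤n 5≤t S sh)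
  λ n 3≤n → 2^k≤n⇒k≤⌊log₂n⌋ 1 (≤-trans (s≤s (s≤s z≤n)) 3≤n) ,
            Digits.family n , shattersAll-≤ (Digits.family n) t≤6 (Digits.shattersAll-six n)
  where
  module Digits n = DigitFamily {n} (suc ⌊log₂ n ⌋) (<⇒≤ (n<2^[1+⌊log₂n⌋] n))

theorem1p2 : ((t : ℕ) → 1 ≤ t → t ≤ 2 → ∃ λ N → (n : ℕ) → N ≤ n → IsF 3 n t t)
    × ((t : ℕ) → 3 ≤ t → t ≤ 4 → IsΘ 3 t loglog)
    × ((t : ℕ) → 5 ≤ t → t ≤ 6 → IsΘ 3 t (λ n → ⌊log₂ n ⌋))
theorem1p2 = f≡t-for-t≤2 , f≡Θloglog-for-t∈3,4 , f≡Θ⌊log₂⌋-for-t∈5,6
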